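{- Let $m,l,h$ be integers with $0\le h<m$, $0<l$, $6\mid m$, and let $a\in\{ -1,1\}$ with $3\mid(l-ah)$. Let $b=\gcd(l-ah,m)$, $c=(m+h-\mathrm{lcm}(h,m))/2$ and, for $r\in\mathbb{Z}$ and $t_r\in\{0,1\}$, $C^{a}(r,t_r)=\{\psi(3r+aj+(j+t_r)c,\ j+(j+t_r)l/2) : j\in\mathbb{Z}\}$. Then: (i) if $\sigma(h)\ge\sigma(m)=\sigma(l)=1$, then for every choice of $t_0,\dots,t_{b/3-1}\in\{0,1\}$, $\bigcup_{r=0}^{b/3-1}C^{a}(r,t_r)$ is a perfect code of $\Gamma''_{m,l,h}$; (ii) if $\sigma(h)\ge\sigma(m)>\sigma(l)\ge1$, then for every choice of $t_0,\dots,t_{b/6-1}\in\{0,1\}$, $\bigcup_{r=0}^{b/6-1}C^{a}(r,t_r)$ is a perfect code of $\Gamma''_{m,l,h}$.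
   Context: $\hat{x}$ is the least nonnegative integer representative of a residue class $x$. $\Gamma_{m,l,h}$ is the graph with vertex set $\mathbb{Z}_m\times\mathbb{Z}_l$ whose edges are $\{(a,b),(a+1,b)\}$ for all $a,b$; $\{(a,c'),(a,c'+1)\}$ for all $a$ and all $c'$ with $\hat{c'}\neq l-1$; and $\{(a,-1),(a-h,0)\}$ for all $a\in\mathbb{Z}_m$. For integers $i,J$, $\psi(i,J)=(i-\lfloor J/l\rfloor h\bmod m,\ J\bmod l)$. With $c$ as in the claim (and $\mathrm{lcm}(m,0)=0$), $\Gamma''_{m,l,h}$ is the graph on $\mathbb{Z}_m\times\mathbb{Z}_l$ in which $(a,b),(a',b')$ are adjacent iff they are adjacent in $\Gamma_{m,l,h}$, or $(a',b')=\psi(\hat a+c,\hat b+l/2)$, or $(a,b)=\psi(\hat a'+c,\hat b'+l/2)$. A perfect code is a vertex set $C$ such that every vertex is at distance at most $1$ from exactly one vertex of $C$. $\sigma(n)$ is the largest nonnegative integer $i$ with $2^i\mid n$ ($\sigma(0)=+\infty$). -}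

module Defs where

open import Data.Nat as ℕ using (ℕ; zero; suc; _<_; _≤_; _∸_; _^_)
open import Data.Nat.Divisibility using (_∣_)
open import Data.Nat.GCD using (gcd)
open import Data.Nat.LCM using (lcm)
open import Data.Integer as ℤ using (ℤ; +_; _+_; _-_; _*_)
open import Data.Integer.DivMod using (_/ℕ_; _%ℕ_)
open import Data.Fin using (Fin; toℕ)
open import Data.Bool using (Bool; true; false)
open import Data.Product using (Σ; _×_; _,_)
open import Data.Sum using (_⊎_)
open import Relation.Nullary using (¬_)
open import Relation.Binary.PropositionalEquality using (_≡_)

-- Vertices of Z_m × Z_l are represented by their least nonnegative
-- representatives: pairs (x , y) of naturals with x < m, y < l.
Vtx : Set
Vtx = ℕ × ℕ

IsVertex : ℕ → ℕ → Vtx → Set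
IsVertex m l (x , y) = x < m × y < l

-- least nonnegative representative of an integer modulo n
-- (n = 0 never occurs in the statement; we return 0 there)
_modN_ : ℤ → ℕ → ℕ
i modN zero    = 0
i modN (suc n) = i %ℕ suc n

-- floor division of an integer by a natural (n = 0 never occurs; returns 0)
_divN_ : ℤ → ℕ → ℤ
i divN zero    = + 0
i divN (suc n) = i /ℕ suc n

ψ : (m l h : ℕ) → ℤ → ℤ → Vtx
ψ m l h i J = ((i - (J divN l) * + h) modN m , J modN l)

-- Edges of Γ_{m,l,h}, each given in one orientation
EdgeΓ : (m l h : ℕ) → Vtx → Vtx → Set
EdgeΓ m l h (x , y) v =
    v ≡ ((+ x + + 1) modN m , y)
  ⊎ (¬ (y ≡ l ∸ 1) × v ≡ (x , (+ y + + 1) modN l))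
  ⊎ (y ≡ l ∸ 1 × v ≡ ((+ x - + h) modN m , 0))

AdjΓ : (m l h : ℕ) → Vtx → Vtx → Set
AdjΓ m l h u v = EdgeΓ m l h u v ⊎ EdgeΓ m l h v u

-- c = (m + h - lcm(h,m)) / 2   (lcm(0,m) = 0)
cVal : (m h : ℕ) → ℤ
cVal m h = (+ m + + h - + lcm h m) divN 2

halfL : ℕ → ℕ
halfL l = l ℕ./ 2

Adj'' : (m l h : ℕ) → Vtx → Vtx → Set
Adj'' m l h (x , y) (x′ , y′) =
    AdjΓ m l h (x , y) (x′ , y′)
  ⊎ (x′ , y′) ≡ ψ m l h (+ x + cVal m h) (+ (y ℕ.+ halfL l))
  ⊎ (x , y) ≡ ψ m l h (+ x′ + cVal m h) (+ (y′ ℕ.+ halfL l))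

PerfectCode : (IsV : Vtx → Set) (Adj : Vtx → Vtx → Set) (C : Vtx → Set) → Set
PerfectCode IsV Adj C =
  (∀ u → C u → IsV u) ×
  (∀ v → IsV v →
     Σ Vtx λ u → (C u × (u ≡ v ⊎ Adj u v)) ×
       (∀ u′ → C u′ → (u′ ≡ v ⊎ Adj u′ v) → u′ ≡ u))

bit : Bool → ℤ
bit false = + 0
bit true  = + 1

InC : (m l h : ℕ) (a : ℤ) (r : ℕ) (t : ℤ) → Vtx → Set
InC m l h a r t v = Σ ℤ λ j →
  v ≡ ψ m l h (+ 3 * + r + a * j + (j + t) * cVal m h)
              (j + (j + t) * + halfL l)

UnionC : (m l h : ℕ) (a : ℤ) (k : ℕ) (t : Fin k → Bool) → Vtx → Set
UnionC m l h a k t v = Σ (Fin k) λ r → InC m l h a (toℕ r) (bit (t r)) v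

bVal : (m l h : ℕ) (a : ℤ) → ℕ
bVal m l h a = gcd ℤ.∣ + l - a * + h ∣ m

-- σ(n) = k  (2-adic valuation; only used for n > 0)
HasVal2 : ℕ → ℕ → Set
HasVal2 n k = (2 ^ k ∣ n) × ¬ (2 ^ suc k ∣ n)

-- σ(n) ≥ k   (true for all k when n = 0, matching σ(0) = +∞)
Val2≥ : ℕ → ℕ → Set
Val2≥ n k = 2 ^ k ∣ n

-- Through ψ, Z_m × Z_l is ℤ²/Λ with Λ = ℤ(m,0) + ℤ(h,l), and Γ'' is the Cayley graph of ℤ²/Λ for the
-- steps ±(1,0), ±(0,1) and g = (c, l/2), an element of order 2.  Hence C is a perfect code iff every
-- class is uniquely a codeword plus one of the tiles 0, ±(1,0), ±(0,1), g.  With u = (a,1) + g the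
-- codewords of C^a(r,t) are (3r,0) + j u + t g.
--
-- Let B = b/2 in case (ii) with l/2 odd and B = b otherwise.  Bézout for b = gcd(l - ah, m) makes
-- (B,0) a multiple of u modulo Λ, so every class is (3r,0) + n u + e g + (d-1,0) with 3r + d < B and
-- e < 2, and a tile absorbs (d-1,0) + (e - t_r) g: this is the covering.  In case (ii) with l/2 even,
-- g ∼ (B/2,0) + j₁ u folds the residues r ≥ B/6 onto r - B/6 with t flipped.  For the packing,
-- characters of ℤ²/Λ separate the pieces: x - ay mod B and y mod 2 when l/2 is odd, x + (B/2 - a)y
-- mod B when l/2 is even.  They see g as 0, resp. B/2, because c - a l/2 ≡ 0 mod B, resp. ≡ B/2 mod
-- B; given that 2(c - a l/2) ≡ 0 mod b, this is exactly where the 2-adic hypotheses enter.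

module Submission where

open import Defs
open import Data.Bool using (Bool; true; false; _xor_)
open import Data.Empty using (⊥; ⊥-elim)
open import Data.Integer as ℤ using (ℤ; +_; -[1+_]; _+_; _-_; _*_; -_; ∣_∣; _◃_)
open import Data.Integer.DivMod using (a≡a%ℕn+[a/ℕn]*n; n%ℕd<d)
import Data.Integer.Properties as ℤP
import Data.Integer.Divisibility as ℤD
open import Data.Integer.Tactic.RingSolver using (solve-∀)
open import Data.Nat as ℕ using (ℕ; zero; suc; _<_; _≤_; _∸_; _/_; _%_; _^_; s≤s; z≤n)
import Data.Nat.Properties as ℕP
import Data.Nat.DivMod as ℕDM
open import Data.Nat.Divisibility using (_∣_; divides; quotient; ∣-trans)
open import Data.Nat.GCD using (gcd; gcd-GCD; gcd[m,n]∣m; gcd[m,n]∣n; gcd[m,n]≢0; gcd-greatest; module Bézout)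
open import Data.Nat.LCM using (lcm; m∣lcm[m,n]; n∣lcm[m,n]; lcm-least)
open import Data.Fin using (Fin; toℕ; fromℕ<)
import Data.Fin.Properties as FinP
open import Data.Sign using (Sign)
open import Data.Product using (Σ; _×_; _,_; proj₁; proj₂)
open import Data.Sum using (_⊎_; inj₁; inj₂)
open import Relation.Binary.PropositionalEquality
open import Relation.Binary.Bundles using (Setoid)
open import Relation.Nullary using (¬_; yes; no)
import Relation.Binary.Reasoning.Setoid as SetoidReasoning

infix 4 _≡_mod_

record _≡_mod_ (x y n : ℤ) : Set where
  constructor _,_
  field
    quotient : ℤ
    difference : x - y ≡ quotient * n

module _ {n : ℤ} where

  mod-reflexive : ∀ {x y} → x ≡ y → x ≡ y mod n
  mod-reflexive {x} refl = + 0 , ℤP.+-inverseʳ x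

  mod-refl : ∀ x → x ≡ x mod n
  mod-refl x = mod-reflexive refl

  mod-sym : ∀ {x y} → x ≡ y mod n → y ≡ x mod n
  mod-sym {x} {y} (q , eq) = - q , (begin
    y - x       ≡⟨ negate x y ⟩
    - (x - y)   ≡⟨ cong -_ eq ⟩
    - (q * n)   ≡⟨ ℤP.neg-distribˡ-* q n ⟩
    - q * n     ∎)
    where
    open ≡-Reasoning
    negate : ∀ x y → y - x ≡ - (x - y)
    negate = solve-∀

  mod-trans : ∀ {x y z} → x ≡ y mod n → y ≡ z mod n → x ≡ z mod n
  mod-trans {x} {y} {z} (q , eq) (q′ , eq′) = q + q′ , (begin
    x - z               ≡⟨ split x y z ⟩
    (x - y) + (y - z)   ≡⟨ cong₂ _+_ eq eq′ ⟩
    q * n + q′ * n      ≡⟨ ℤP.*-distribʳ-+ n q q′ ⟨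
    (q + q′) * n        ∎)
    where
    open ≡-Reasoning
    split : ∀ x y z → x - z ≡ (x - y) + (y - z)
    split = solve-∀

  mod-+ : ∀ {x y x′ y′} → x ≡ y mod n → x′ ≡ y′ mod n → x + x′ ≡ y + y′ mod n
  mod-+ {x} {y} {x′} {y′} (q , eq) (q′ , eq′) = q + q′ , (begin
    (x + x′) - (y + y′)   ≡⟨ interchange x y x′ y′ ⟩
    (x - y) + (x′ - y′)   ≡⟨ cong₂ _+_ eq eq′ ⟩
    q * n + q′ * n        ≡⟨ ℤP.*-distribʳ-+ n q q′ ⟨
    (q + q′) * n          ∎)
    where
    open ≡-Reasoning
    interchange : ∀ x y x′ y′ → (x + x′) - (y + y′) ≡ (x - y) + (x′ - y′)
    interchange = solve-∀

  mod-*ˡ : ∀ k {x y} → x ≡ y mod n → k * x ≡ k * y mod n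
  mod-*ˡ k {x} {y} (q , eq) = k * q , (begin
    k * x - k * y   ≡⟨ distrib k x y ⟩
    k * (x - y)     ≡⟨ cong (k *_) eq ⟩
    k * (q * n)     ≡⟨ ℤP.*-assoc k q n ⟨
    k * q * n       ∎)
    where
    open ≡-Reasoning
    distrib : ∀ k x y → k * x - k * y ≡ k * (x - y)
    distrib = solve-∀

  multiple≡0 : ∀ q → q * n ≡ + 0 mod n
  multiple≡0 q = q , ℤP.+-identityʳ (q * n)

mod-neg : ∀ {x y n} → x ≡ y mod n → - x ≡ - y mod n
mod-neg {x} {y} {n} (q , eq) = - q , (begin
  - x - - y    ≡⟨ negate x y ⟩
  - (x - y)    ≡⟨ cong -_ eq ⟩
  - (q * n)    ≡⟨ ℤP.neg-distribˡ-* q n ⟩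
  - q * n      ∎)
  where
  open ≡-Reasoning
  negate : ∀ x y → - x - - y ≡ - (x - y)
  negate = solve-∀

mod-setoid : ℤ → Setoid _ _
mod-setoid n = record
  { Carrier = ℤ ; _≈_ = λ x y → x ≡ y mod n
  ; isEquivalence = record { refl = mod-reflexive refl ; sym = mod-sym ; trans = mod-trans } }

module mod-Reasoning (n : ℤ) = SetoidReasoning (mod-setoid n)

mod-cancelˡ : ∀ {n} k {x y} → k + x ≡ k + y mod n → x ≡ y mod n
mod-cancelˡ k {x} {y} (q , eq) = q , trans (cancel k x y) eq
  where
  cancel : ∀ k x y → x - y ≡ (k + x) - (k + y)
  cancel = solve-∀

mod-scale : ∀ k {x y n} → x ≡ y mod n → k * x ≡ k * y mod (k * n)
mod-scale k {x} {y} {n} (q , eq) = q , (begin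
  k * x - k * y   ≡⟨ distrib k x y ⟩
  k * (x - y)     ≡⟨ cong (k *_) eq ⟩
  k * (q * n)     ≡⟨ swap k q n ⟩
  q * (k * n)     ∎)
  where
  open ≡-Reasoning
  distrib : ∀ k x y → k * x - k * y ≡ k * (x - y)
  distrib = solve-∀
  swap : ∀ k q n → k * (q * n) ≡ q * (k * n)
  swap = solve-∀

mod-divisor : ∀ {x y n} k → x ≡ y mod (n * k) → x ≡ y mod n
mod-divisor {n = n} k (q , eq) = q * k , trans eq (swap q n k)
  where
  swap : ∀ q n k → q * (n * k) ≡ q * k * n
  swap = solve-∀

mod-absorb : ∀ x k n → x + k * n ≡ x mod n
mod-absorb x k n = k , absorb x k n
  where
  absorb : ∀ x k n → x + k * n - x ≡ k * n
  absorb = solve-∀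

mod-cancelʳ-factor : ∀ {x y} k n .{{_ : ℤ.NonZero k}} → x * k ≡ y * k mod (k * n) → x ≡ y mod n
mod-cancelʳ-factor {x} {y} k n (q , eq) = q , ℤP.*-cancelʳ-≡ (x - y) (q * n) k (begin
  (x - y) * k     ≡⟨ distrib x y k ⟩
  x * k - y * k   ≡⟨ eq ⟩
  q * (k * n)     ≡⟨ swap q k n ⟩
  q * n * k       ∎)
  where
  open ≡-Reasoning
  distrib : ∀ x y k → (x - y) * k ≡ x * k - y * k
  distrib = solve-∀
  swap : ∀ q k n → q * (k * n) ≡ q * n * k
  swap = solve-∀

k*n<n⇒k≡0 : ∀ k n → k ℕ.* n < n → k ≡ 0
k*n<n⇒k≡0 zero    n _  = refl
k*n<n⇒k≡0 (suc k) n lt = ⊥-elim (ℕP.<⇒≱ lt (ℕP.m≤n*m n (suc k)))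

bounded-multiple≡0 : ∀ {x y n} (q : ℤ) → x < n → y < n → + x - + y ≡ q * + n → q ≡ + 0
bounded-multiple≡0 {x} {y} {n} q x<n y<n eq =
  ℤP.∣i∣≡0⇒i≡0 (k*n<n⇒k≡0 ∣ q ∣ n (begin-strict
    ∣ q ∣ ℕ.* n     ≡⟨ ℤP.abs-* q (+ n) ⟨
    ∣ q * + n ∣     ≡⟨ cong ∣_∣ eq ⟨
    ∣ + x - + y ∣   ≡⟨ cong ∣_∣ (ℤP.[+m]-[+n]≡m⊖n x y) ⟩
    ∣ x ℤ.⊖ y ∣     ≤⟨ ℤP.∣m⊝n∣≤m⊔n x y ⟩
    x ℕ.⊔ y         <⟨ ℕP.⊔-lub x<n y<n ⟩
    n               ∎))
  where open ℕP.≤-Reasoning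

bounded-mod⇒≡ : ∀ {x y n} → x < n → y < n → + x ≡ + y mod + n → x ≡ y
bounded-mod⇒≡ {x} {y} {n} x<n y<n (q , eq) =
  ℤP.+-injective (ℤP.i-j≡0⇒i≡j (+ x) (+ y) (trans eq (cong (_* + n) (bounded-multiple≡0 q x<n y<n eq))))

base3-bound : ∀ {r K d} → r < K → d < 3 → 3 ℕ.* r ℕ.+ d < K ℕ.* 3
base3-bound {r} {K} {d} r<K d<3 = begin-strict
  3 ℕ.* r ℕ.+ d    <⟨ ℕP.+-monoʳ-< (3 ℕ.* r) d<3 ⟩
  3 ℕ.* r ℕ.+ 3    ≡⟨ ℕP.+-comm (3 ℕ.* r) 3 ⟩
  3 ℕ.+ 3 ℕ.* r    ≡⟨ ℕP.*-suc 3 r ⟨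
  3 ℕ.* suc r      ≤⟨ ℕP.*-monoʳ-≤ 3 r<K ⟩
  3 ℕ.* K          ≡⟨ ℕP.*-comm 3 K ⟩
  K ℕ.* 3          ∎
  where open ℕP.≤-Reasoning

base3-last : ∀ r {d} → d < 3 → (3 ℕ.* r ℕ.+ d) % 3 ≡ d
base3-last r {d} d<3 = begin
  (3 ℕ.* r ℕ.+ d) % 3   ≡⟨ cong (_% 3) (trans (ℕP.+-comm (3 ℕ.* r) d) (cong (d ℕ.+_) (ℕP.*-comm 3 r))) ⟩
  (d ℕ.+ r ℕ.* 3) % 3   ≡⟨ ℕDM.[m+kn]%n≡m%n d r 3 ⟩
  d % 3                 ≡⟨ ℕDM.m<n⇒m%n≡m d<3 ⟩
  d                     ∎
  where open ≡-Reasoning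

base3-injective : ∀ {r r′ d d′} → d < 3 → d′ < 3 → 3 ℕ.* r ℕ.+ d ≡ 3 ℕ.* r′ ℕ.+ d′ → r ≡ r′ × d ≡ d′
base3-injective {r} {r′} {d} {d′} d<3 d′<3 eq = r≡r′ , d≡d′
  where
  d≡d′ : d ≡ d′
  d≡d′ = trans (sym (base3-last r d<3)) (trans (cong (_% 3) eq) (base3-last r′ d′<3))
  r≡r′ : r ≡ r′
  r≡r′ = ℕP.*-cancelˡ-≡ r r′ 3
           (ℕP.+-cancelʳ-≡ d (3 ℕ.* r) (3 ℕ.* r′) (trans eq (cong (3 ℕ.* r′ ℕ.+_) (sym d≡d′))))

base3-mod-injective : ∀ {K r r′ d d′} → r < K → r′ < K → d < 3 → d′ < 3 →
                      + 3 * + r + + d ≡ + 3 * + r′ + + d′ mod + (K ℕ.* 3) → r ≡ r′ × d ≡ d′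
base3-mod-injective {K} {r} {r′} {d} {d′} r<K r′<K d<3 d′<3 (q , eq) =
  base3-injective d<3 d′<3 (bounded-mod⇒≡ (base3-bound r<K d<3) (base3-bound r′<K d′<3)
                                          (q , trans (cong₂ _-_ (as-pos r d) (as-pos r′ d′)) eq))
  where
  as-pos : ∀ r d → + (3 ℕ.* r ℕ.+ d) ≡ + 3 * + r + + d
  as-pos r d = trans (ℤP.pos-+ (3 ℕ.* r) d) (cong (_+ + d) (ℤP.pos-* 3 r))

below-double : ∀ {ρ K} → ρ < K ℕ.+ K → ρ < K ⊎ Σ ℕ λ r → r < K × ρ ≡ r ℕ.+ K
below-double {ρ} {K} ρ<2K with ρ ℕ.<? K
... | yes ρ<K = inj₁ ρ<K
... | no ρ≮K = inj₂ (ρ ℕ.∸ K , r<K , sym (ℕP.m∸n+n≡m K≤ρ))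
  where
  K≤ρ = ℕP.≮⇒≥ ρ≮K
  r<K : ρ ℕ.∸ K < K
  r<K = subst (ρ ℕ.∸ K <_) (ℕP.m+n∸n≡m K K) (ℕP.∸-monoˡ-< ρ<2K K≤ρ)

+1-below : ∀ {y n} → y < n → ¬ (y ≡ n ∸ 1) → y ℕ.+ 1 < n
+1-below {y} {suc n} (s≤s y≤n) y≢n with ℕP.m≤n⇒m<n∨m≡n y≤n
... | inj₁ y<n = subst (_< suc n) (ℕP.+-comm 1 y) (s≤s y<n)
... | inj₂ y≡n = ⊥-elim (y≢n y≡n)

divN-modN : ∀ i {n} → 0 < n → i ≡ + (i modN n) + (i divN n) * + n
divN-modN i {suc n} _ = a≡a%ℕn+[a/ℕn]*n i (suc n)

modN-< : ∀ i {n} → 0 < n → i modN n < n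
modN-< i {suc n} _ = n%ℕd<d i (suc n)

modN-congruent : ∀ i {n} → 0 < n → + (i modN n) ≡ i mod + n
modN-congruent i {n} 0<n = - (i divN n) , (begin
  + r - i                   ≡⟨ cong (λ t → + r - t) (divN-modN i 0<n) ⟩
  + r - (+ r + d * + n)     ≡⟨ cancel (+ r) d (+ n) ⟩
  - d * + n                 ∎)
  where
  open ≡-Reasoning
  r = i modN n
  d = i divN n
  cancel : ∀ r d n → r - (r + d * n) ≡ - d * n
  cancel = solve-∀

divN-exact : ∀ X {n} → 0 < n → X ≡ + 0 mod + n → X ≡ (X divN n) * + n
divN-exact X {n} 0<n X≡0 = begin
  X                                ≡⟨ divN-modN X 0<n ⟩
  + (X modN n) + (X divN n) * + n  ≡⟨ cong (λ r → + r + (X divN n) * + n) remainder≡0 ⟩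
  + 0 + (X divN n) * + n           ≡⟨ ℤP.+-identityˡ ((X divN n) * + n) ⟩
  (X divN n) * + n                 ∎
  where
  open ≡-Reasoning
  remainder≡0 : X modN n ≡ 0
  remainder≡0 = bounded-mod⇒≡ (modN-< X 0<n) 0<n (mod-trans (modN-congruent X 0<n) X≡0)

modN-small : ∀ {k n} → k < n → (+ k) modN n ≡ k
modN-small {k} k<n = bounded-mod⇒≡ (modN-< (+ k) 0<n) k<n (modN-congruent (+ k) 0<n)
  where 0<n = ℕP.<-≤-trans (s≤s z≤n) k<n

∣⇒≡0-mod : ∀ {n k} → n ∣ k → + k ≡ + 0 mod + n
∣⇒≡0-mod {n} (divides q refl) = + q , trans (ℤP.+-identityʳ (+ (q ℕ.* n))) (ℤP.pos-* q n)

≡0-mod⇒∣ : ∀ {n x} → x ≡ + 0 mod + n → n ∣ ∣ x ∣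
≡0-mod⇒∣ {n} {x} (q , eq) = divides ∣ q ∣ (begin
  ∣ x ∣           ≡⟨ cong ∣_∣ (ℤP.+-identityʳ x) ⟨
  ∣ x - + 0 ∣     ≡⟨ cong ∣_∣ eq ⟩
  ∣ q * + n ∣     ≡⟨ ℤP.abs-* q (+ n) ⟩
  ∣ q ∣ ℕ.* n     ∎)
  where open ≡-Reasoning

∣abs⇒≡0-mod : ∀ {n} x → n ∣ ∣ x ∣ → x ≡ + 0 mod + n
∣abs⇒≡0-mod (+ k) n∣k = ∣⇒≡0-mod n∣k
∣abs⇒≡0-mod {n} -[1+ k ] n∣k with ∣⇒≡0-mod {n} n∣k
... | q , eq = - q , (begin
  -[1+ k ] - + 0              ≡⟨ negate (+ suc k) ⟩
  - (+ suc k - + 0)           ≡⟨ cong -_ eq ⟩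
  - (q * + n)                 ≡⟨ ℤP.neg-distribˡ-* q (+ n) ⟩
  - q * + n                   ∎)
  where
  open ≡-Reasoning
  negate : ∀ x → - x - + 0 ≡ - (x - + 0)
  negate = solve-∀

abs-as-multiple : ∀ x → Σ ℤ λ s → + ∣ x ∣ ≡ s * x
abs-as-multiple (+ k)    = + 1 , sym (ℤP.*-identityˡ (+ k))
abs-as-multiple -[1+ k ] = - + 1 , sym (ℤP.-1*i≡-i -[1+ k ])

bezout : ∀ x n → Σ ℤ λ X → Σ ℤ λ Y → + gcd ∣ x ∣ n ≡ X * x + Y * + n
bezout x n with Bézout.identity (gcd-GCD ∣ x ∣ n) | abs-as-multiple x
... | Bézout.+- u v eq | s , ∣x∣≡ = + u * s , - + v , (begin
  + d                           ≡⟨ isolate (+ d) (+ v * + n) ⟩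
  (+ d + + v * + n) - + v * + n ≡⟨ cong (λ z → z - + v * + n) (lift eq) ⟩
  + u * + ∣ x ∣ - + v * + n     ≡⟨ cong (λ z → + u * z - + v * + n) ∣x∣≡ ⟩
  + u * (s * x) - + v * + n     ≡⟨ regroup (+ u) s x (+ v) (+ n) ⟩
  + u * s * x + - + v * + n     ∎)
  where
  open ≡-Reasoning
  d = gcd ∣ x ∣ n
  lift : d ℕ.+ v ℕ.* n ≡ u ℕ.* ∣ x ∣ → + d + + v * + n ≡ + u * + ∣ x ∣
  lift e = trans (cong (λ z → + d + z) (sym (ℤP.pos-* v n))) (trans (cong +_ e) (ℤP.pos-* u ∣ x ∣))
  isolate : ∀ d w → d ≡ (d + w) - w
  isolate = solve-∀
  regroup : ∀ u s x v n → u * (s * x) - v * n ≡ u * s * x + - v * n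
  regroup = solve-∀
... | Bézout.-+ u v eq | s , ∣x∣≡ = - (+ u * s) , + v , (begin
  + d                           ≡⟨ isolate (+ d) (+ u * + ∣ x ∣) ⟩
  (+ d + + u * + ∣ x ∣) - + u * + ∣ x ∣ ≡⟨ cong (λ z → z - + u * + ∣ x ∣) (lift eq) ⟩
  + v * + n - + u * + ∣ x ∣     ≡⟨ cong (λ z → + v * + n - + u * z) ∣x∣≡ ⟩
  + v * + n - + u * (s * x)     ≡⟨ regroup (+ u) s x (+ v) (+ n) ⟩
  - (+ u * s) * x + + v * + n   ∎)
  where
  open ≡-Reasoning
  d = gcd ∣ x ∣ n
  lift : d ℕ.+ u ℕ.* ∣ x ∣ ≡ v ℕ.* n → + d + + u * + ∣ x ∣ ≡ + v * + n
  lift e = trans (cong (λ z → + d + z) (sym (ℤP.pos-* u ∣ x ∣))) (trans (cong +_ e) (ℤP.pos-* v n))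
  isolate : ∀ d w → d ≡ (d + w) - w
  isolate = solve-∀
  regroup : ∀ u s x v n → v * n - u * (s * x) ≡ - (u * s) * x + v * n
  regroup = solve-∀

parity : ∀ x → x ≡ + 0 mod + 2 ⊎ x ≡ + 1 mod + 2
parity x with x modN 2 | modN-congruent x {2} (s≤s z≤n) | modN-< x {2} (s≤s z≤n)
... | 0 | x≡0 | _ = inj₁ (mod-sym x≡0)
... | 1 | x≡1 | _ = inj₂ (mod-sym x≡1)
... | suc (suc _) | _ | s≤s (s≤s ())

parity-bit : ∀ J → Σ Bool λ e → bit e ≡ J mod + 2
parity-bit J with parity J
... | inj₁ J≡0 = false , mod-sym J≡0
... | inj₂ J≡1 = true , mod-sym J≡1

even-odd-⊥ : ∀ {x} → x ≡ + 0 mod + 2 → x ≡ + 1 mod + 2 → ⊥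
even-odd-⊥ x≡0 x≡1 with bounded-mod⇒≡ {0} {1} {2} (s≤s z≤n) (s≤s (s≤s z≤n)) (mod-trans (mod-sym x≡0) x≡1)
... | ()

odd-factor : ∀ x {y} → x * y ≡ + 1 mod + 2 → y ≡ + 1 mod + 2
odd-factor x {y} xy≡1 with parity y
... | inj₂ y≡1 = y≡1
... | inj₁ y≡0 = ⊥-elim (even-odd-⊥ (mod-trans (mod-*ˡ x y≡0) (mod-reflexive (ℤP.*-zeroʳ x))) xy≡1)

even-factor : ∀ {x y} → x * y ≡ + 0 mod + 2 → y ≡ + 1 mod + 2 → x ≡ + 0 mod + 2
even-factor {x} {y} xy≡0 y≡1 with parity x
... | inj₁ x≡0 = x≡0
... | inj₂ x≡1 = ⊥-elim (even-odd-⊥ xy≡0 (mod-trans (mod-*ˡ x y≡1) (mod-trans (mod-reflexive (ℤP.*-identityʳ x)) x≡1)))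

half-odd : ∀ {n} → 2 ∣ n → ¬ (4 ∣ n) → + (n / 2) ≡ + 1 mod + 2
half-odd {n} 2∣n 4∤n with parity (+ (n / 2))
... | inj₂ odd = odd
... | inj₁ even with ≡0-mod⇒∣ even
...   | divides q eq = ⊥-elim (4∤n (divides q (begin
  n                 ≡⟨ ℕDM.m/n*n≡m 2∣n ⟨
  n / 2 ℕ.* 2       ≡⟨ cong (ℕ._* 2) eq ⟩
  q ℕ.* 2 ℕ.* 2     ≡⟨ ℕP.*-assoc q 2 2 ⟩
  q ℕ.* 4           ∎)))
  where open ≡-Reasoning

halves : ∀ {n} → 2 ∣ n → + n ≡ + (n / 2) * + 2
halves {n} 2∣n = trans (cong +_ (sym (ℕDM.m/n*n≡m 2∣n))) (ℤP.pos-* (n / 2) 2)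

double-cancel : ∀ {Y q H} → Y + Y ≡ q * (H * + 2) → Y ≡ q * H
double-cancel {Y} {q} {H} eq = ℤP.*-cancelʳ-≡ Y (q * H) (+ 2) (trans (double Y) (trans eq (reassoc q H)))
  where
  double : ∀ Y → Y * + 2 ≡ Y + Y
  double = solve-∀
  reassoc : ∀ q H → q * (H * + 2) ≡ q * H * + 2
  reassoc = solve-∀

2^-∣ : ∀ {i j} → i ≤ j → 2 ^ i ∣ 2 ^ j
2^-∣ {i} {j} i≤j = divides (2 ^ (j ℕ.∸ i)) (begin
  2 ^ j                       ≡⟨ cong (2 ^_) (ℕP.m+[n∸m]≡n i≤j) ⟨
  2 ^ (i ℕ.+ (j ℕ.∸ i))       ≡⟨ ℕP.^-distribˡ-+-* 2 i (j ℕ.∸ i) ⟩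
  2 ^ i ℕ.* 2 ^ (j ℕ.∸ i)     ≡⟨ ℕP.*-comm (2 ^ i) (2 ^ (j ℕ.∸ i)) ⟩
  2 ^ (j ℕ.∸ i) ℕ.* 2 ^ i     ∎)
  where open ≡-Reasoning

sign-odd : ∀ σ → σ ◃ 1 ≡ + 1 mod + 2
sign-odd Sign.+ = + 0 , refl
sign-odd Sign.- = - + 1 , refl

sign-square : ∀ σ → (σ ◃ 1) * (σ ◃ 1) ≡ + 1
sign-square Sign.+ = refl
sign-square Sign.- = refl

V : Set
V = ℤ × ℤ

infixl 6 _⊕_ _⊖_
infixr 7 _·_

_⊕_ : V → V → V
(x , y) ⊕ (x′ , y′) = (x + x′ , y + y′)

_⊖_ : V → V → V
(x , y) ⊖ (x′ , y′) = (x - x′ , y - y′)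

_·_ : ℤ → V → V
k · (x , y) = (k * x , k * y)

𝟎 : V
𝟎 = (+ 0 , + 0)

toV : Vtx → V
toV (x , y) = (+ x , + y)

⊕-𝟎 : ∀ P → P ⊕ 𝟎 ≡ P
⊕-𝟎 (x , y) = cong₂ _,_ (ℤP.+-identityʳ x) (ℤP.+-identityʳ y)

⊖-self : ∀ P → P ⊖ P ≡ 𝟎
⊖-self (x , y) = cong₂ _,_ (ℤP.+-inverseʳ x) (ℤP.+-inverseʳ y)

⊖-𝟎 : ∀ P → P ⊖ 𝟎 ≡ P
⊖-𝟎 (x , y) = cong₂ _,_ (ℤP.+-identityʳ x) (ℤP.+-identityʳ y)

⊖-swap : ∀ P Q → Q ⊖ P ≡ - + 1 · (P ⊖ Q)
⊖-swap (x , y) (x′ , y′) = cong₂ _,_ (swap x x′) (swap y y′)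
  where
  swap : ∀ a b → b - a ≡ - + 1 * (a - b)
  swap = solve-∀

⊖-split : ∀ P Q R → P ⊖ R ≡ (P ⊖ Q) ⊕ (Q ⊖ R)
⊖-split (x , y) (x′ , y′) (x″ , y″) = cong₂ _,_ (split x x′ x″) (split y y′ y″)
  where
  split : ∀ a b c → a - c ≡ (a - b) + (b - c)
  split = solve-∀

⊖-interchange : ∀ P Q P′ Q′ → (P ⊕ Q) ⊖ (P′ ⊕ Q′) ≡ (P ⊖ P′) ⊕ (Q ⊖ Q′)
⊖-interchange (x , y) (u , v) (x′ , y′) (u′ , v′) =
  cong₂ _,_ (interchange x u x′ u′) (interchange y v y′ v′)
  where
  interchange : ∀ a b a′ b′ → (a + b) - (a′ + b′) ≡ (a - a′) + (b - b′)
  interchange = solve-∀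

·-distrib-⊖ : ∀ k P Q → k · P ⊖ k · Q ≡ k · (P ⊖ Q)
·-distrib-⊖ k (x , y) (x′ , y′) = cong₂ _,_ (distrib k x x′) (distrib k y y′)
  where
  distrib : ∀ k a b → k * a - k * b ≡ k * (a - b)
  distrib = solve-∀

·-distribʳ-+ : ∀ x y P → (x + y) · P ≡ x · P ⊕ y · P
·-distribʳ-+ x y (p , q) = cong₂ _,_ (ℤP.*-distribʳ-+ p x y) (ℤP.*-distribʳ-+ q x y)

⊕-regroup : ∀ A N T E D → A ⊕ N ⊕ (T ⊕ E) ⊕ D ≡ (A ⊕ N ⊕ T) ⊕ (D ⊕ E)
⊕-regroup (a , a′) (n , n′) (t , t′) (e , e′) (d , d′) =
  cong₂ _,_ (regroup a n t e d) (regroup a′ n′ t′ e′ d′)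
  where
  regroup : ∀ a n t e d → a + n + (t + e) + d ≡ (a + n + t) + (d + e)
  regroup = solve-∀

⊕-collect : ∀ A n k U T S → (A ⊕ n · U ⊕ T) ⊕ (k · U ⊕ S) ≡ (A ⊕ (n + k) · U ⊕ T) ⊕ S
⊕-collect (a , a′) n k (x , x′) (t , t′) (s , s′) =
  cong₂ _,_ (collect a n k x t s) (collect a′ n k x′ t′ s′)
  where
  collect : ∀ a n k x t s → (a + n * x + t) + (k * x + s) ≡ (a + (n + k) * x + t) + s
  collect = solve-∀

⊕-shuffle : ∀ A n k U D E → A ⊕ n · U ⊕ D ⊕ k · U ⊕ E ≡ A ⊕ (n + k) · U ⊕ E ⊕ D
⊕-shuffle (a , a′) n k (x , x′) (d , d′) (e , e′) =
  cong₂ _,_ (shuffle a n k x d e) (shuffle a′ n k x′ d′ e′)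
  where
  shuffle : ∀ a n k x d e → a + n * x + d + k * x + e ≡ a + (n + k) * x + e + d
  shuffle = solve-∀

-- The lattice Λ and the quotient ℤ²/Λ

module Lattice (m l h : ℕ) where

  InΛ : V → Set
  InΛ (x , y) = Σ ℤ λ p → Σ ℤ λ q → x ≡ p * + m + q * + h × y ≡ q * + l

  Λ-𝟎 : InΛ 𝟎
  Λ-𝟎 = + 0 , + 0 , refl , refl

  Λ-m : InΛ (+ m , + 0)
  Λ-m = + 1 , + 0 , sym (trans (ℤP.+-identityʳ (+ 1 * + m)) (ℤP.*-identityˡ (+ m))) , refl

  Λ-hl : InΛ (+ h , + l)
  Λ-hl = + 0 , + 1 , sym (trans (ℤP.+-identityˡ (+ 1 * + h)) (ℤP.*-identityˡ (+ h))) , sym (ℤP.*-identityˡ (+ l))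

  Λ-⊕ : ∀ {P Q} → InΛ P → InΛ Q → InΛ (P ⊕ Q)
  Λ-⊕ (p , q , ex , ey) (p′ , q′ , ex′ , ey′) =
    p + p′ , q + q′ ,
    trans (cong₂ _+_ ex ex′) (sum₁ p q p′ q′ (+ m) (+ h)) ,
    trans (cong₂ _+_ ey ey′) (sym (ℤP.*-distribʳ-+ (+ l) q q′))
    where
    sum₁ : ∀ p q p′ q′ m h → (p * m + q * h) + (p′ * m + q′ * h) ≡ (p + p′) * m + (q + q′) * h
    sum₁ = solve-∀

  Λ-· : ∀ k {P} → InΛ P → InΛ (k · P)
  Λ-· k (p , q , ex , ey) =
    k * p , k * q ,
    trans (cong (k *_) ex) (scale₁ k p q (+ m) (+ h)) ,
    trans (cong (k *_) ey) (sym (ℤP.*-assoc k q (+ l)))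
    where
    scale₁ : ∀ k p q m h → k * (p * m + q * h) ≡ k * p * m + k * q * h
    scale₁ = solve-∀

  infix 4 _∼_

  record _∼_ (P Q : V) : Set where
    constructor ∼-by
    field difference∈Λ : InΛ (P ⊖ Q)

  ∼-refl : ∀ {P} → P ∼ P
  ∼-refl {P} = ∼-by (subst InΛ (sym (⊖-self P)) Λ-𝟎)

  ∼-sym : ∀ {P Q} → P ∼ Q → Q ∼ P
  ∼-sym {P} {Q} (∼-by d) = ∼-by (subst InΛ (sym (⊖-swap P Q)) (Λ-· (- + 1) d))

  ∼-trans : ∀ {P Q R} → P ∼ Q → Q ∼ R → P ∼ R
  ∼-trans {P} {Q} {R} (∼-by d) (∼-by d′) = ∼-by (subst InΛ (sym (⊖-split P Q R)) (Λ-⊕ d d′))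

  ∼-⊕ : ∀ {P Q P′ Q′} → P ∼ P′ → Q ∼ Q′ → P ⊕ Q ∼ P′ ⊕ Q′
  ∼-⊕ {P} {Q} {P′} {Q′} (∼-by d) (∼-by d′) =
    ∼-by (subst InΛ (sym (⊖-interchange P Q P′ Q′)) (Λ-⊕ d d′))

  ∼-⊕ˡ : ∀ P {Q Q′} → Q ∼ Q′ → P ⊕ Q ∼ P ⊕ Q′
  ∼-⊕ˡ P = ∼-⊕ (∼-refl {P})

  ∼-⊕ʳ : ∀ Q {P P′} → P ∼ P′ → P ⊕ Q ∼ P′ ⊕ Q
  ∼-⊕ʳ Q p∼ = ∼-⊕ p∼ (∼-refl {Q})

  ∼-· : ∀ k {P Q} → P ∼ Q → k · P ∼ k · Q
  ∼-· k {P} {Q} (∼-by d) = ∼-by (subst InΛ (sym (·-distrib-⊖ k P Q)) (Λ-· k d))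

  ∼-reflexive : ∀ {P Q} → P ≡ Q → P ∼ Q
  ∼-reflexive refl = ∼-refl

  Λ⇒∼𝟎 : ∀ {P} → InΛ P → P ∼ 𝟎
  Λ⇒∼𝟎 {P} d = ∼-by (subst InΛ (sym (⊖-𝟎 P)) d)

  ∼-setoid : Setoid _ _
  ∼-setoid = record
    { Carrier = V ; _≈_ = _∼_
    ; isEquivalence = record { refl = ∼-refl ; sym = ∼-sym ; trans = ∼-trans } }

  module ∼-Reasoning = SetoidReasoning ∼-setoid

  module Character (N α β : ℤ) (α-m : α * + m ≡ + 0 mod N) (αβ-hl : α * + h + β * + l ≡ + 0 mod N) where

    χ : V → ℤ
    χ (x , y) = α * x + β * y

    χ-⊕ : ∀ P Q → χ (P ⊕ Q) ≡ χ P + χ Q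
    χ-⊕ (x , y) (x′ , y′) = additive α β x y x′ y′
      where
      additive : ∀ α β x y x′ y′ → α * (x + x′) + β * (y + y′) ≡ (α * x + β * y) + (α * x′ + β * y′)
      additive = solve-∀

    χ-Λ : ∀ {P} → InΛ P → χ P ≡ + 0 mod N
    χ-Λ {x , y} (p , q , ex , ey) = begin
      α * x + β * y                                  ≡⟨ cong₂ (λ s t → α * s + β * t) ex ey ⟩
      α * (p * + m + q * + h) + β * (q * + l)        ≡⟨ expand α β p q (+ m) (+ h) (+ l) ⟩
      p * (α * + m) + q * (α * + h + β * + l)        ≈⟨ mod-+ (mod-*ˡ p α-m) (mod-*ˡ q αβ-hl) ⟩
      p * + 0 + q * + 0                              ≡⟨ cong₂ _+_ (ℤP.*-zeroʳ p) (ℤP.*-zeroʳ q) ⟩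
      + 0                                            ∎
      where
      open mod-Reasoning N
      expand : ∀ α β p q m h l → α * (p * m + q * h) + β * (q * l) ≡ p * (α * m) + q * (α * h + β * l)
      expand = solve-∀

    χ-∼ : ∀ {P Q} → P ∼ Q → χ P ≡ χ Q mod N
    χ-∼ {x , y} {x′ , y′} (∼-by d) = q , trans (linear α β x y x′ y′) eq
      where
      open _≡_mod_ (χ-Λ d) renaming (quotient to q; difference to eq)
      linear : ∀ α β x y x′ y′ → (α * x + β * y) - (α * x′ + β * y′) ≡ (α * (x - x′) + β * (y - y′)) - + 0
      linear = solve-∀

  ψ∼ : 0 < m → 0 < l → ∀ i J → toV (ψ m l h i J) ∼ (i , J)
  ψ∼ 0<m 0<l i J = ∼-sym (∼-by (p , q , x-difference , y-difference))
    where
    q = J divN l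
    p = (i - q * + h) divN m
    x = (i - q * + h) modN m
    y = J modN l
    rearrange : ∀ i x qh → i - x ≡ (i - qh) - x + qh
    rearrange = solve-∀
    cancel : ∀ x pm qh → (x + pm) - x + qh ≡ pm + qh
    cancel = solve-∀
    cancelˡ : ∀ y ql → (y + ql) - y ≡ ql
    cancelˡ = solve-∀
    x-difference : i - + x ≡ p * + m + q * + h
    x-difference = begin
      i - + x                       ≡⟨ rearrange i (+ x) (q * + h) ⟩
      (i - q * + h) - + x + q * + h ≡⟨ cong (λ t → t - + x + q * + h) (divN-modN (i - q * + h) 0<m) ⟩
      (+ x + p * + m) - + x + q * + h ≡⟨ cancel (+ x) (p * + m) (q * + h) ⟩
      p * + m + q * + h             ∎
      where open ≡-Reasoning
    y-difference : J - + y ≡ q * + l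
    y-difference = begin
      J - + y                   ≡⟨ cong (_- + y) (divN-modN J 0<l) ⟩
      (+ y + q * + l) - + y     ≡⟨ cancelˡ (+ y) (q * + l) ⟩
      q * + l                   ∎
      where open ≡-Reasoning

  ψ-vertex : 0 < m → 0 < l → ∀ i J → IsVertex m l (ψ m l h i J)
  ψ-vertex 0<m 0<l i J = modN-< _ 0<m , modN-< J 0<l

  ∼-vertex⇒≡ : ∀ {u v} → IsVertex m l u → IsVertex m l v → toV u ∼ toV v → u ≡ v
  ∼-vertex⇒≡ {x , y} {x′ , y′} (x<m , y<l) (x′<m , y′<l) (∼-by (p , q , ex , ey)) =
    cong₂ _,_ (bounded-mod⇒≡ x<m x′<m (p , ex′)) (bounded-mod⇒≡ y<l y′<l (q , ey))
    where
    ex′ : + x - + x′ ≡ p * + m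
    ex′ = trans ex (trans (cong (λ r → p * + m + r * + h) (bounded-multiple≡0 q y<l y′<l ey))
                          (ℤP.+-identityʳ (p * + m)))

  ∼-flip : ∀ {A B} S → A ∼ B ⊕ S → B ∼ A ⊕ - + 1 · S
  ∼-flip {a , b} {a′ , b′} (s , t) (∼-by d) = ∼-by (subst InΛ (cong₂ _,_ (flip a a′ s) (flip b b′ t)) (Λ-· (- + 1) d))
    where
    flip : ∀ a a′ s → - + 1 * (a - (a′ + s)) ≡ a′ - (a + - + 1 * s)
    flip = solve-∀

  modN-∼ : 0 < m → ∀ i y → (+ (i modN m) , y) ∼ (i , y)
  modN-∼ 0<m i y = ∼-by (q , + 0 , trans eq (sym (ℤP.+-identityʳ (q * + m))) , ℤP.+-inverseʳ y)
    where
    open _≡_mod_ (modN-congruent i 0<m) renaming (quotient to q; difference to eq)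

  g : V
  g = (cVal m h , + halfL l)

-- Γ'' as a Cayley graph, tilings and perfect codes

data Tile : Set where
  here east west north south across : Tile

-- A tile is determined by the values 1 + x - a y ∈ {0,1,2} and y mod 2 on its step (x , y).
digit : Sign → Tile → ℕ
digit _      here   = 1
digit _      east   = 2
digit _      west   = 0
digit _      across = 1
digit Sign.+ north  = 0
digit Sign.- north  = 2
digit Sign.+ south  = 2
digit Sign.- south  = 0

vertical : Tile → ℕ
vertical here   = 0
vertical east   = 0
vertical west   = 0
vertical north  = 1
vertical south  = 1
vertical across = 1

digit<3 : ∀ σ s → digit σ s < 3
digit<3 _      here   = s≤s (s≤s z≤n)
digit<3 _      east   = s≤s (s≤s (s≤s z≤n))
digit<3 _      west   = s≤s z≤n
digit<3 _      across = s≤s (s≤s z≤n)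
digit<3 Sign.+ north  = s≤s z≤n
digit<3 Sign.- north  = s≤s (s≤s (s≤s z≤n))
digit<3 Sign.+ south  = s≤s (s≤s (s≤s z≤n))
digit<3 Sign.- south  = s≤s z≤n

vertical<2 : ∀ s → vertical s < 2
vertical<2 here   = s≤s z≤n
vertical<2 east   = s≤s z≤n
vertical<2 west   = s≤s z≤n
vertical<2 north  = s≤s (s≤s z≤n)
vertical<2 south  = s≤s (s≤s z≤n)
vertical<2 across = s≤s (s≤s z≤n)

tile-at : Sign → ℕ → ℕ → Tile
tile-at _      0 0 = west
tile-at _      1 0 = here
tile-at _      _ 0 = east
tile-at _      1 _ = across
tile-at Sign.+ 0 _ = north
tile-at Sign.- 0 _ = south
tile-at Sign.+ _ _ = south
tile-at Sign.- _ _ = north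

tile-at-digit-vertical : ∀ σ s → tile-at σ (digit σ s) (vertical s) ≡ s
tile-at-digit-vertical _      here   = refl
tile-at-digit-vertical _      east   = refl
tile-at-digit-vertical _      west   = refl
tile-at-digit-vertical _      across = refl
tile-at-digit-vertical Sign.+ north  = refl
tile-at-digit-vertical Sign.- north  = refl
tile-at-digit-vertical Sign.+ south  = refl
tile-at-digit-vertical Sign.- south  = refl

tile-injective : ∀ σ {s s′} → digit σ s ≡ digit σ s′ → vertical s ≡ vertical s′ → s ≡ s′
tile-injective σ {s} {s′} d≡ v≡ =
  trans (sym (tile-at-digit-vertical σ s)) (trans (cong₂ (tile-at σ) d≡ v≡) (tile-at-digit-vertical σ s′))

module Cayley (m l h : ℕ) (0<m : 0 < m) (0<l : 0 < l)
              (g⊕g∈Λ : Lattice.InΛ m l h (Lattice.g m l h ⊕ Lattice.g m l h)) where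
  open Lattice m l h

  step : Tile → V
  step here   = 𝟎
  step east   = (+ 1 , + 0)
  step west   = (- + 1 , + 0)
  step north  = (+ 0 , + 1)
  step south  = (+ 0 , - + 1)
  step across = g

  -g∼g : - + 1 · g ∼ g
  -g∼g = ∼-by (subst InΛ (cong₂ _,_ (negate (cVal m h)) (negate (+ halfL l))) (Λ-· (- + 1) g⊕g∈Λ))
    where
    negate : ∀ x → - + 1 * (x + x) ≡ - + 1 * x - x
    negate = solve-∀

  east-∼ : ∀ x y → toV ((+ x + + 1) modN m , y) ∼ toV (x , y) ⊕ step east
  east-∼ x y = ∼-trans (modN-∼ 0<m (+ x + + 1) (+ y)) (∼-reflexive (cong (+ x + + 1 ,_) (sym (ℤP.+-identityʳ (+ y)))))

  north-∼ : ∀ {x y} → y ℕ.+ 1 < l → toV (x , (+ y + + 1) modN l) ∼ toV (x , y) ⊕ step north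
  north-∼ {x} {y} y+1<l = ∼-reflexive (cong₂ _,_ (sym (ℤP.+-identityʳ (+ x))) (cong +_ (modN-small y+1<l)))

  wrap-∼ : ∀ {x y} → y ≡ l ∸ 1 → toV ((+ x - + h) modN m , 0) ∼ toV (x , y) ⊕ step north
  wrap-∼ {x} {y} refl =
    ∼-trans (modN-∼ 0<m (+ x - + h) (+ 0))
      (∼-trans (∼-by wrap) (∼-reflexive (cong₂ _,_ (sym (ℤP.+-identityʳ (+ x))) (cong +_ (sym (ℕP.m∸n+n≡m 0<l))))))
    where
    x-part : ∀ x h m → x - h - x ≡ + 0 * m + - + 1 * h
    x-part = solve-∀
    y-part : ∀ l → + 0 - l ≡ - + 1 * l
    y-part = solve-∀
    wrap : InΛ ((+ x - + h , + 0) ⊖ (+ x , + l))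
    wrap = + 0 , - + 1 , x-part (+ x) (+ h) (+ m) , y-part (+ l)

  edge⇒step : ∀ {u v} → IsVertex m l u → EdgeΓ m l h u v → toV v ∼ toV u ⊕ step east ⊎ toV v ∼ toV u ⊕ step north
  edge⇒step {x , y} _ (inj₁ refl) = inj₁ (east-∼ x y)
  edge⇒step {x , y} (_ , y<l) (inj₂ (inj₁ (y≢l-1 , refl))) = inj₂ (north-∼ (+1-below y<l y≢l-1))
  edge⇒step {x , y} _ (inj₂ (inj₂ (y≡l-1 , refl))) = inj₂ (wrap-∼ y≡l-1)

  step⇒edge : ∀ {u v} → IsVertex m l u → IsVertex m l v →
              toV v ∼ toV u ⊕ step east ⊎ toV v ∼ toV u ⊕ step north → EdgeΓ m l h u v
  step⇒edge {x , y} (_ , y<l) vv (inj₁ v∼) =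
    inj₁ (∼-vertex⇒≡ vv (modN-< _ 0<m , y<l) (∼-trans v∼ (∼-sym (east-∼ x y))))
  step⇒edge {x , y} (x<m , y<l) vv (inj₂ v∼) with y ℕ.≟ l ∸ 1
  ... | yes y≡l-1 =
    inj₂ (inj₂ (y≡l-1 , ∼-vertex⇒≡ vv (modN-< _ 0<m , 0<l) (∼-trans v∼ (∼-sym (wrap-∼ y≡l-1)))))
  ... | no y≢l-1 =
    inj₂ (inj₁ (y≢l-1 , ∼-vertex⇒≡ vv (x<m , modN-< _ 0<l) (∼-trans v∼ (∼-sym (north-∼ (+1-below y<l y≢l-1))))))

  across-∼ : ∀ x y → toV (ψ m l h (+ x + cVal m h) (+ (y ℕ.+ halfL l))) ∼ toV (x , y) ⊕ step across
  across-∼ x y = ψ∼ 0<m 0<l _ _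

  adjacent⇒step : ∀ {u v} → IsVertex m l u → IsVertex m l v → Adj'' m l h u v →
                  Σ Tile λ s → toV v ∼ toV u ⊕ step s
  adjacent⇒step uv _ (inj₁ (inj₁ e)) with edge⇒step uv e
  ... | inj₁ v∼ = east , v∼
  ... | inj₂ v∼ = north , v∼
  adjacent⇒step _ vv (inj₁ (inj₂ e)) with edge⇒step vv e
  ... | inj₁ u∼ = west , ∼-flip (step east) u∼
  ... | inj₂ u∼ = south , ∼-flip (step north) u∼
  adjacent⇒step {x , y} _ _ (inj₂ (inj₁ refl)) = across , across-∼ x y
  adjacent⇒step {u} {x , y} _ _ (inj₂ (inj₂ refl)) =
    across , ∼-trans (∼-flip g (across-∼ x y)) (∼-⊕ˡ (toV u) -g∼g)

  step⇒adjacent : ∀ {u v} s → IsVertex m l u → IsVertex m l v → toV v ∼ toV u ⊕ step s →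
                  u ≡ v ⊎ Adj'' m l h u v
  step⇒adjacent {u} here uv vv v∼ =
    inj₁ (∼-vertex⇒≡ uv vv (∼-sym (∼-trans v∼ (∼-reflexive (⊕-𝟎 (toV u))))))
  step⇒adjacent east  uv vv v∼ = inj₂ (inj₁ (inj₁ (step⇒edge uv vv (inj₁ v∼))))
  step⇒adjacent north uv vv v∼ = inj₂ (inj₁ (inj₁ (step⇒edge uv vv (inj₂ v∼))))
  step⇒adjacent west  uv vv v∼ = inj₂ (inj₁ (inj₂ (step⇒edge vv uv (inj₁ (∼-flip (step west) v∼)))))
  step⇒adjacent south uv vv v∼ = inj₂ (inj₁ (inj₂ (step⇒edge vv uv (inj₂ (∼-flip (step south) v∼)))))
  step⇒adjacent {x , y} across _ vv v∼ =
    inj₂ (inj₂ (inj₁ (∼-vertex⇒≡ vv (ψ-vertex 0<m 0<l (+ x + cVal m h) (+ (y ℕ.+ halfL l)))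
                                     (∼-trans v∼ (∼-sym (across-∼ x y))))))

  neighbour⇒step : ∀ {u v} → IsVertex m l u → IsVertex m l v → u ≡ v ⊎ Adj'' m l h u v →
                   Σ Tile λ s → toV v ∼ toV u ⊕ step s
  neighbour⇒step {u} _ _ (inj₁ refl) = here , ∼-reflexive (sym (⊕-𝟎 (toV u)))
  neighbour⇒step uv vv (inj₂ u~v) = adjacent⇒step uv vv u~v

  ∼-cancelʳ : ∀ {P Q} S → P ⊕ S ∼ Q ⊕ S → P ∼ Q
  ∼-cancelʳ {x , y} {x′ , y′} (s , t) (∼-by d) = ∼-by (subst InΛ (cong₂ _,_ (cancel x x′ s) (cancel y y′ t)) d)
    where
    cancel : ∀ a b s → (a + s) - (b + s) ≡ a - b
    cancel = solve-∀

  codeword : ℤ → ℕ → ℤ → ℤ → V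
  codeword a r t j = (+ 3 * + r + a * j + (j + t) * cVal m h , j + (j + t) * + halfL l)

  module Tiling (a : ℤ) (K : ℕ) (t : Fin K → Bool) where

    centre : Fin K → ℤ → V
    centre r j = codeword a (toℕ r) (bit (t r)) j

    Covering : Set
    Covering = ∀ P → Σ (Fin K) λ r → Σ ℤ λ j → Σ Tile λ s → P ∼ centre r j ⊕ step s

    Packing : Set
    Packing = ∀ {r r′ j j′ s s′} → centre r j ⊕ step s ∼ centre r′ j′ ⊕ step s′ → r ≡ r′ × s ≡ s′

    code-vertex : Fin K → ℤ → Vtx
    code-vertex r j = ψ m l h (proj₁ (centre r j)) (proj₂ (centre r j))

    code-vertex-valid : ∀ r j → IsVertex m l (code-vertex r j)
    code-vertex-valid r j = ψ-vertex 0<m 0<l (proj₁ (centre r j)) (proj₂ (centre r j))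

    code-vertex∼centre : ∀ r j → toV (code-vertex r j) ∼ centre r j
    code-vertex∼centre r j = ψ∼ 0<m 0<l (proj₁ (centre r j)) (proj₂ (centre r j))

    ∼-code-vertex : ∀ {v} r j s → toV v ∼ centre r j ⊕ step s → toV v ∼ toV (code-vertex r j) ⊕ step s
    ∼-code-vertex r j s v∼ = ∼-trans v∼ (∼-⊕ʳ (step s) (∼-sym (code-vertex∼centre r j)))

    nearby-codeword-unique : Packing → ∀ {v} r j s → IsVertex m l v → toV v ∼ toV (code-vertex r j) ⊕ step s →
      ∀ r′ j′ → code-vertex r′ j′ ≡ v ⊎ Adj'' m l h (code-vertex r′ j′) v → code-vertex r′ j′ ≡ code-vertex r j
    nearby-codeword-unique pack {v} r j s vv v∼ r′ j′ near =
      same-tile (neighbour⇒step (code-vertex-valid r′ j′) vv near)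
      where
      same-tile : Σ Tile (λ s′ → toV v ∼ toV (code-vertex r′ j′) ⊕ step s′) → code-vertex r′ j′ ≡ code-vertex r j
      same-tile (s′ , v∼′) = same-centre (pack (∼-trans (∼-⊕ʳ (step s′) (∼-sym (code-vertex∼centre r′ j′)))
                                                         (∼-trans (∼-sym v∼′) (∼-trans v∼ (∼-⊕ʳ (step s) (code-vertex∼centre r j))))))
        where
        same-centre : r′ ≡ r × s′ ≡ s → code-vertex r′ j′ ≡ code-vertex r j
        same-centre (refl , refl) = ∼-vertex⇒≡ (code-vertex-valid r′ j′) (code-vertex-valid r j)
                                      (∼-cancelʳ (step s) (∼-trans (∼-sym v∼′) v∼))

    tiling⇒perfect-code : Covering → Packing → PerfectCode (IsVertex m l) (Adj'' m l h) (UnionC m l h a K t)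
    tiling⇒perfect-code cover pack = codewords-valid , unique-codeword-nearby
      where
      codewords-valid : ∀ u → UnionC m l h a K t u → IsVertex m l u
      codewords-valid _ (r , j , refl) = code-vertex-valid r j

      unique-codeword-nearby : ∀ v → IsVertex m l v →
        Σ Vtx λ u → (UnionC m l h a K t u × (u ≡ v ⊎ Adj'' m l h u v)) ×
          (∀ u′ → UnionC m l h a K t u′ → (u′ ≡ v ⊎ Adj'' m l h u′ v) → u′ ≡ u)
      unique-codeword-nearby v vv =
        code-vertex r j , ((r , j , refl) , step⇒adjacent s (code-vertex-valid r j) vv v∼) , unique
        where
        r = proj₁ (cover (toV v))
        j = proj₁ (proj₂ (cover (toV v)))
        s = proj₁ (proj₂ (proj₂ (cover (toV v))))
        v∼ : toV v ∼ toV (code-vertex r j) ⊕ step s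
        v∼ = ∼-code-vertex r j s (proj₂ (proj₂ (proj₂ (cover (toV v)))))
        unique : ∀ u′ → UnionC m l h a K t u′ → (u′ ≡ v ⊎ Adj'' m l h u′ v) → u′ ≡ code-vertex r j
        unique _ (r′ , j′ , refl) = nearby-codeword-unique pack r j s vv v∼ r′ j′

  axis : Sign → V
  axis σ = ((σ ◃ 1) + cVal m h , + 1 + + halfL l)

  ∼-by-g⊕g : ∀ {P Q} → P ⊖ Q ≡ g ⊕ g → P ∼ Q
  ∼-by-g⊕g eq = ∼-by (subst InΛ (sym eq) g⊕g∈Λ)

  west-across-tile : ∀ σ → Σ Tile λ s → Σ ℤ λ k → (+ 0 - + 1 , + 0) ⊕ bit true · g ∼ k · axis σ ⊕ step s
  west-across-tile Sign.+ = north , - + 1 , ∼-by-g⊕g (cong₂ _,_ (first (cVal m h)) (second (+ halfL l)))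
    where
    first : ∀ c → (- + 1 + + 1 * c) - (- + 1 * (+ 1 + c) + + 0) ≡ c + c
    first = solve-∀
    second : ∀ x → (+ 0 + + 1 * x) - (- + 1 * (+ 1 + x) + + 1) ≡ x + x
    second = solve-∀
  west-across-tile Sign.- = south , + 1 , ∼-reflexive (cong₂ _,_ (first (cVal m h)) (second (+ halfL l)))
    where
    first : ∀ c → - + 1 + + 1 * c ≡ + 1 * (- + 1 + c) + + 0
    first = solve-∀
    second : ∀ x → + 0 + + 1 * x ≡ + 1 * (+ 1 + x) + - + 1
    second = solve-∀

  east-across-tile : ∀ σ → Σ Tile λ s → Σ ℤ λ k → (+ 2 - + 1 , + 0) ⊕ bit true · g ∼ k · axis σ ⊕ step s
  east-across-tile Sign.+ = south , + 1 , ∼-reflexive (cong₂ _,_ (first (cVal m h)) (second (+ halfL l)))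
    where
    first : ∀ c → + 1 + + 1 * c ≡ + 1 * (+ 1 + c) + + 0
    first = solve-∀
    second : ∀ x → + 0 + + 1 * x ≡ + 1 * (+ 1 + x) + - + 1
    second = solve-∀
  east-across-tile Sign.- = north , - + 1 , ∼-by-g⊕g (cong₂ _,_ (first (cVal m h)) (second (+ halfL l)))
    where
    first : ∀ c → (+ 1 + + 1 * c) - (- + 1 * (- + 1 + c) + + 0) ≡ c + c
    first = solve-∀
    second : ∀ x → (+ 0 + + 1 * x) - (- + 1 * (+ 1 + x) + + 1) ≡ x + x
    second = solve-∀

  skew-step : ∀ σ {N} → cVal m h - (σ ◃ 1) * + halfL l ≡ + 0 mod N → ∀ s →
              + 1 * proj₁ (step s) + - (σ ◃ 1) * proj₂ (step s) ≡ + digit σ s - + 1 mod N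
  skew-step Sign.+ _ here   = mod-reflexive refl
  skew-step Sign.- _ here   = mod-reflexive refl
  skew-step Sign.+ _ east   = mod-reflexive refl
  skew-step Sign.- _ east   = mod-reflexive refl
  skew-step Sign.+ _ west   = mod-reflexive refl
  skew-step Sign.- _ west   = mod-reflexive refl
  skew-step Sign.+ _ north  = mod-reflexive refl
  skew-step Sign.- _ north  = mod-reflexive refl
  skew-step Sign.+ _ south  = mod-reflexive refl
  skew-step Sign.- _ south  = mod-reflexive refl
  skew-step σ Y≡0 across = mod-trans (mod-reflexive (unit (σ ◃ 1) (cVal m h) (+ halfL l))) Y≡0
    where
    unit : ∀ a c x → + 1 * c + - a * x ≡ c - a * x
    unit = solve-∀

  vertical-step : + halfL l ≡ + 1 mod + 2 → ∀ s → + 0 * proj₁ (step s) + + 1 * proj₂ (step s) ≡ + vertical s mod + 2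
  vertical-step _ here   = mod-reflexive refl
  vertical-step _ east   = mod-reflexive refl
  vertical-step _ west   = mod-reflexive refl
  vertical-step _ north  = mod-reflexive refl
  vertical-step _ south  = - + 1 , refl
  vertical-step hl≡1 across = mod-trans (mod-reflexive (unit (cVal m h) (+ halfL l))) hl≡1
    where
    unit : ∀ c x → + 0 * c + + 1 * x ≡ x
    unit = solve-∀

  twisted-horizontal : ∀ a H d → + 1 * d + (H - a) * + 0 ≡ d + + 0 * H
  twisted-horizontal = solve-∀

  twisted-step : ∀ σ {H} → cVal m h - (σ ◃ 1) * + halfL l ≡ + H mod (+ H * + 2) → + halfL l ≡ + 0 mod + 2 → ∀ s →
                 + 1 * proj₁ (step s) + (+ H - (σ ◃ 1)) * proj₂ (step s) ≡
                 (+ digit σ s - + 1) + + vertical s * + H mod (+ H * + 2)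
  twisted-step σ {H} _ _ here = mod-reflexive (twisted-horizontal (σ ◃ 1) (+ H) (+ 0))
  twisted-step σ {H} _ _ east = mod-reflexive (twisted-horizontal (σ ◃ 1) (+ H) (+ 1))
  twisted-step σ {H} _ _ west = mod-reflexive (twisted-horizontal (σ ◃ 1) (+ H) (- + 1))
  twisted-step Sign.+ {H} _ _ north = mod-reflexive (up (+ H))
    where
    up : ∀ H → + 1 * + 0 + (H - + 1) * + 1 ≡ - + 1 + + 1 * H
    up = solve-∀
  twisted-step Sign.- {H} _ _ north = mod-reflexive (up (+ H))
    where
    up : ∀ H → + 1 * + 0 + (H - - + 1) * + 1 ≡ + 1 + + 1 * H
    up = solve-∀
  twisted-step Sign.+ {H} _ _ south = - + 1 , down (+ H)
    where
    down : ∀ H → (+ 1 * + 0 + (H - + 1) * - + 1) - (+ 1 + + 1 * H) ≡ - + 1 * (H * + 2)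
    down = solve-∀
  twisted-step Sign.- {H} _ _ south = - + 1 , down (+ H)
    where
    down : ∀ H → (+ 1 * + 0 + (H - - + 1) * - + 1) - (- + 1 + + 1 * H) ≡ - + 1 * (H * + 2)
    down = solve-∀
  twisted-step σ {H} Y≡H hl≡0 across = begin
    + 1 * c + (+ H - a) * x        ≡⟨ regroup a c x (+ H) ⟩
    (c - a * x) + + H * x          ≈⟨ mod-+ Y≡H (mod-scale (+ H) hl≡0) ⟩
    + H + + H * + 0                ≡⟨ settle (+ H) ⟩
    (+ 1 - + 1) + + 1 * + H        ∎
    where
    open mod-Reasoning (+ H * + 2)
    a = σ ◃ 1
    c = cVal m h
    x = + halfL l
    regroup : ∀ a c x H → + 1 * c + (H - a) * x ≡ (c - a * x) + H * x
    regroup = solve-∀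
    settle : ∀ H → H + H * + 0 ≡ (+ 1 - + 1) + + 1 * H
    settle = solve-∀

  module Signed (σ : Sign) where

    a : ℤ
    a = σ ◃ 1

    u : V
    u = axis σ

    codeword-decomposition : ∀ r t j → codeword a r t j ≡ (+ 3 * + r , + 0) ⊕ j · u ⊕ t · g
    codeword-decomposition r t j =
      cong₂ _,_ (first (+ 3 * + r) a j t (cVal m h)) (second j t (+ halfL l))
      where
      first : ∀ r a j t c → r + a * j + (j + t) * c ≡ r + j * (a + c) + t * c
      first = solve-∀
      second : ∀ j t x → j + (j + t) * x ≡ + 0 + j * (+ 1 + x) + t * x
      second = solve-∀

    ·g-mod-2 : ∀ x y → x ≡ y mod + 2 → x · g ∼ y · g
    ·g-mod-2 x y (q , eq) = ∼-by (subst InΛ (sym difference) (Λ-· q g⊕g∈Λ))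
      where
      factor : ∀ x y z → x * z - y * z ≡ (x - y) * z
      factor = solve-∀
      halve : ∀ q z → q * + 2 * z ≡ q * (z + z)
      halve = solve-∀
      difference : x · g ⊖ y · g ≡ q · (g ⊕ g)
      difference = cong₂ _,_
        (trans (factor x y (cVal m h)) (trans (cong (_* cVal m h) eq) (halve q (cVal m h))))
        (trans (factor x y (+ halfL l)) (trans (cong (_* + halfL l) eq) (halve q (+ halfL l))))

    tile : ∀ d → d < 3 → ∀ ε → Σ Tile λ s → Σ ℤ λ k → (+ d - + 1 , + 0) ⊕ bit ε · g ∼ k · u ⊕ step s
    tile 0 _ false = west , + 0 , ∼-refl
    tile 1 _ false = here , + 0 , ∼-refl
    tile 2 _ false = east , + 0 , ∼-refl
    tile 1 _ true  = across , + 0 , ∼-reflexive (cong₂ _,_ (one (cVal m h)) (one (+ halfL l)))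
      where
      one : ∀ x → + 0 + + 1 * x ≡ + 0 + x
      one = solve-∀
    tile 0 _ true  = west-across-tile σ
    tile 2 _ true  = east-across-tile σ
    tile (suc (suc (suc _))) (s≤s (s≤s (s≤s ()))) _

    bit-split : ∀ e t → bit e ≡ bit t + bit (t xor e) mod + 2
    bit-split false false = + 0 , refl
    bit-split false true  = - + 1 , refl
    bit-split true  false = + 0 , refl
    bit-split true  true  = + 0 , refl

    NormalForm : ℕ → V → Set
    NormalForm K P = Σ ℕ λ r → r < K × Σ ℕ λ d → d < 3 × Σ Bool λ e → Σ ℤ λ n →
                     P ∼ (+ 3 * + r , + 0) ⊕ n · u ⊕ bit e · g ⊕ (+ d - + 1 , + 0)

    normal-forms-cover : ∀ {K} (t : Fin K → Bool) → (∀ P → NormalForm K P) → Tiling.Covering a K t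
    normal-forms-cover t normal-form P with normal-form P
    ... | r , r<K , d , d<3 , e , n , P∼ with tile d d<3 (t r′ xor e)
      where r′ = fromℕ< r<K
    ...   | s , k , D⊕εg∼ = r′ , n + k , s , (begin
      P                                  ≈⟨ P∼ ⟩
      (+ 3 * + r , + 0) ⊕ n · u ⊕ bit e · g ⊕ D
                                         ≡⟨ cong (λ z → (+ 3 * + z , + 0) ⊕ n · u ⊕ bit e · g ⊕ D) (sym (FinP.toℕ-fromℕ< r<K)) ⟩
      A ⊕ n · u ⊕ bit e · g ⊕ D           ≈⟨ ∼-⊕ʳ D (∼-⊕ˡ (A ⊕ n · u) e·g∼) ⟩
      A ⊕ n · u ⊕ (bit (t r′) · g ⊕ bit ε · g) ⊕ D
                                         ≡⟨ ⊕-regroup A (n · u) (bit (t r′) · g) (bit ε · g) D ⟩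
      (A ⊕ n · u ⊕ bit (t r′) · g) ⊕ (D ⊕ bit ε · g)
                                         ≈⟨ ∼-⊕ˡ (A ⊕ n · u ⊕ bit (t r′) · g) D⊕εg∼ ⟩
      (A ⊕ n · u ⊕ bit (t r′) · g) ⊕ (k · u ⊕ step s)
                                         ≡⟨ ⊕-collect A n k u (bit (t r′) · g) (step s) ⟩
      (A ⊕ (n + k) · u ⊕ bit (t r′) · g) ⊕ step s
                                         ≡⟨ cong (_⊕ step s) (codeword-decomposition (toℕ r′) (bit (t r′)) (n + k)) ⟨
      Tiling.centre a _ t r′ (n + k) ⊕ step s ∎)
      where
      open ∼-Reasoning
      r′ = fromℕ< r<K
      A = (+ 3 * + toℕ r′ , + 0)
      D = (+ d - + 1 , + 0)
      ε = t r′ xor e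
      e·g∼ : bit e · g ∼ bit (t r′) · g ⊕ bit ε · g
      e·g∼ = ∼-trans (·g-mod-2 (bit e) (bit (t r′) + bit ε) (bit-split e (t r′)))
                     (∼-reflexive (·-distribʳ-+ (bit (t r′)) (bit ε) g))

    axis-form : ∀ i J e → bit e ≡ J mod + 2 → (i , J) ∼ (i - a * J , + 0) ⊕ J · u ⊕ bit e · g
    axis-form i J e (q , e-J) = begin
      (i , J)                                   ≡⟨ cong₂ _,_ (first i a J (cVal m h)) (second J (+ halfL l)) ⟩
      (i - a * J , + 0) ⊕ J · u ⊕ (- J) · g     ≈⟨ ∼-⊕ˡ ((i - a * J , + 0) ⊕ J · u) (·g-mod-2 (- J) (bit e) (q - bit e , -J≡e)) ⟩
      (i - a * J , + 0) ⊕ J · u ⊕ bit e · g     ∎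
      where
      open ∼-Reasoning
      first : ∀ i a J c → i ≡ i - a * J + J * (a + c) + (- J) * c
      first = solve-∀
      second : ∀ J x → J ≡ + 0 + J * (+ 1 + x) + (- J) * x
      second = solve-∀
      negate : ∀ J b → - J - b ≡ (b - J) - b * + 2
      negate = solve-∀
      factor : ∀ q b → q * + 2 - b * + 2 ≡ (q - b) * + 2
      factor = solve-∀
      -J≡e : - J - bit e ≡ (q - bit e) * + 2
      -J≡e = trans (negate J (bit e)) (trans (cong (_- bit e * + 2) e-J) (factor q (bit e)))

    digits : ∀ ρ → + ρ ≡ + 3 * + (ρ / 3) + + (ρ % 3)
    digits ρ = begin
      + ρ                           ≡⟨ cong +_ (ℕDM.m≡m%n+[m/n]*n ρ 3) ⟩
      + (ρ % 3 ℕ.+ ρ / 3 ℕ.* 3)     ≡⟨ cong +_ (ℕP.+-comm (ρ % 3) (ρ / 3 ℕ.* 3)) ⟩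
      + (ρ / 3 ℕ.* 3) + + (ρ % 3)   ≡⟨ cong (_+ + (ρ % 3)) (ℤP.pos-* (ρ / 3) 3) ⟩
      + (ρ / 3) * + 3 + + (ρ % 3)   ≡⟨ cong (_+ + (ρ % 3)) (ℤP.*-comm (+ (ρ / 3)) (+ 3)) ⟩
      + 3 * + (ρ / 3) + + (ρ % 3)   ∎
      where open ≡-Reasoning

    Reduced : ℕ → ℤ → Set
    Reduced B x = Σ ℕ λ ρ → ρ < B × Σ ℤ λ n →
                  (x , + 0) ∼ (+ 3 * + (ρ / 3) , + 0) ⊕ n · u ⊕ (+ (ρ % 3) - + 1 , + 0)

    reduce : ∀ {B j₀} → 0 < B → (+ B , + 0) ∼ j₀ · u → ∀ x → Reduced B x
    reduce {B} {j₀} 0<B B∼ x = ρ , modN-< (x + + 1) 0<B , q * j₀ , (begin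
      (x , + 0)                                        ≡⟨ cong₂ _,_ (shift x) refl ⟩
      (x + + 1 , + 0) ⊕ (- + 1 , + 0)
        ≡⟨ cong₂ (λ y z → (y , z) ⊕ (- + 1 , + 0)) (divN-modN (x + + 1) 0<B)
                 (sym (trans (ℤP.+-identityˡ (q * + 0)) (ℤP.*-zeroʳ q))) ⟩
      (+ ρ , + 0) ⊕ q · (+ B , + 0) ⊕ (- + 1 , + 0)    ≈⟨ ∼-⊕ʳ (- + 1 , + 0) (∼-⊕ˡ (+ ρ , + 0) (∼-· q B∼)) ⟩
      (+ ρ , + 0) ⊕ q · (j₀ · u) ⊕ (- + 1 , + 0)       ≡⟨ cong₂ _,_ first second ⟩
      (+ 3 * + (ρ / 3) , + 0) ⊕ (q * j₀) · u ⊕ (+ (ρ % 3) - + 1 , + 0) ∎)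
      where
      open ∼-Reasoning
      ρ = (x + + 1) modN B
      q = (x + + 1) divN B
      shift : ∀ x → x ≡ x + + 1 + - + 1
      shift = solve-∀
      regroup : ∀ A d q j x → A + d + q * (j * x) + - + 1 ≡ A + (q * j) * x + (d - + 1)
      regroup = solve-∀
      first : + ρ + q * (j₀ * proj₁ u) + - + 1 ≡ + 3 * + (ρ / 3) + (q * j₀) * proj₁ u + (+ (ρ % 3) - + 1)
      first = trans (cong (λ z → z + q * (j₀ * proj₁ u) + - + 1) (digits ρ))
                    (regroup (+ 3 * + (ρ / 3)) (+ (ρ % 3)) q j₀ (proj₁ u))
      reassoc : ∀ q j y → + 0 + q * (j * y) + + 0 ≡ + 0 + (q * j) * y + + 0
      reassoc = solve-∀
      second : + 0 + q * (j₀ * proj₂ u) + + 0 ≡ + 0 + (q * j₀) * proj₂ u + + 0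
      second = reassoc q j₀ (proj₂ u)

    normal-form-A : ∀ {B K j₀} → 0 < B → B ≡ K ℕ.* 3 → (+ B , + 0) ∼ j₀ · u → ∀ P → NormalForm K P
    normal-form-A {B} {K} {j₀} 0<B B≡ B∼ (i , J) =
      ρ / 3 , ℕDM.m<n*o⇒m/o<n (subst (ρ <_) B≡ (proj₁ (proj₂ reduced))) , ρ % 3 , ℕDM.m%n<n ρ 3 , e , n + J , (begin
        (i , J)                                    ≈⟨ axis-form i J e e≡J ⟩
        (i - a * J , + 0) ⊕ J · u ⊕ bit e · g      ≈⟨ ∼-⊕ʳ (bit e · g) (∼-⊕ʳ (J · u) x∼) ⟩
        A ⊕ n · u ⊕ D ⊕ J · u ⊕ bit e · g          ≡⟨ ⊕-shuffle A n J u D (bit e · g) ⟩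
        A ⊕ (n + J) · u ⊕ bit e · g ⊕ D            ∎)
      where
      open ∼-Reasoning
      e = proj₁ (parity-bit J)
      e≡J = proj₂ (parity-bit J)
      reduced = reduce {B} {j₀} 0<B B∼ (i - a * J)
      ρ = proj₁ reduced
      n = proj₁ (proj₂ (proj₂ reduced))
      x∼ = proj₂ (proj₂ (proj₂ reduced))
      A = (+ 3 * + (ρ / 3) , + 0)
      D = (+ (ρ % 3) - + 1 , + 0)

    fold-across : ∀ {H j₁} → g ∼ (+ H , + 0) ⊕ j₁ · u → ∀ x J e →
                  (x , + 0) ⊕ J · u ⊕ bit e · g ∼ (x + bit e * + H , + 0) ⊕ (J + bit e * j₁) · u
    fold-across {H} {j₁} g∼ x J e = begin
      (x , + 0) ⊕ J · u ⊕ bit e · g                           ≈⟨ ∼-⊕ˡ ((x , + 0) ⊕ J · u) (∼-· (bit e) g∼) ⟩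
      (x , + 0) ⊕ J · u ⊕ bit e · ((+ H , + 0) ⊕ j₁ · u)      ≡⟨ cong₂ _,_ (first x J (bit e) (+ H) j₁ (proj₁ u))
                                                                           (second J (bit e) j₁ (proj₂ u)) ⟩
      (x + bit e * + H , + 0) ⊕ (J + bit e * j₁) · u          ∎
      where
      open ∼-Reasoning
      first : ∀ x J e H j y → x + J * y + e * (H + j * y) ≡ (x + e * H) + (J + e * j) * y
      first = solve-∀
      second : ∀ J e j y → + 0 + J * y + e * (+ 0 + j * y) ≡ + 0 + (J + e * j) * y
      second = solve-∀

    upper-half : ∀ {H K j₁} → H ≡ K ℕ.* 3 → g ∼ (+ H , + 0) ⊕ j₁ · u → ∀ r N D →
                 (+ 3 * + (r ℕ.+ K) , + 0) ⊕ N · u ⊕ bit false · g ⊕ D ∼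
                 (+ 3 * + r , + 0) ⊕ (N - j₁) · u ⊕ bit true · g ⊕ D
    upper-half {H} {K} {j₁} H≡ g∼ r N D@(d₁ , d₂) = begin
      (+ 3 * + (r ℕ.+ K) , + 0) ⊕ N · u ⊕ bit false · g ⊕ D
        ≡⟨ cong (λ z → (z , + 0) ⊕ N · u ⊕ bit false · g ⊕ D) split ⟩
      (+ 3 * + r + + H , + 0) ⊕ N · u ⊕ bit false · g ⊕ D
        ≈⟨ ∼-⊕ʳ D (∼-⊕ʳ (bit false · g) (∼-⊕ʳ (N · u) (∼-⊕ˡ (+ 3 * + r , + 0) H∼))) ⟩
      ((+ 3 * + r , + 0) ⊕ (g ⊕ (- j₁) · u)) ⊕ N · u ⊕ bit false · g ⊕ D
        ≡⟨ cong₂ _,_ (collect (+ 3 * + r) (cVal m h) j₁ (proj₁ u) N d₁)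
                     (collect (+ 0) (+ halfL l) j₁ (proj₂ u) N d₂) ⟩
      (+ 3 * + r , + 0) ⊕ (N - j₁) · u ⊕ bit true · g ⊕ D  ∎
      where
      open ∼-Reasoning
      distrib : ∀ r K → + 3 * (r + K) ≡ + 3 * r + + 3 * K
      distrib = solve-∀
      split : + 3 * + (r ℕ.+ K) ≡ + 3 * + r + + H
      split = trans (distrib (+ r) (+ K))
                    (cong (λ z → + 3 * + r + z) (sym (trans (cong +_ H≡) (trans (ℤP.pos-* K 3) (ℤP.*-comm (+ K) (+ 3))))))
      collect : ∀ A c j x N d → A + (c + - j * x) + N * x + + 0 * c + d ≡ A + (N - j) * x + + 1 * c + d
      collect = solve-∀
      cancel : ∀ H j x → H + j * x + - j * x ≡ H
      cancel = solve-∀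
      H∼ : (+ H , + 0) ∼ g ⊕ (- j₁) · u
      H∼ = ∼-sym (∼-trans (∼-⊕ʳ ((- j₁) · u) g∼)
                          (∼-reflexive (cong₂ _,_ (cancel (+ H) j₁ (proj₁ u)) (cancel (+ 0) j₁ (proj₂ u)))))

    normal-form-C : ∀ {H K j₀ j₁} → 0 < H → H ≡ K ℕ.* 3 → (+ (H ℕ.+ H) , + 0) ∼ j₀ · u →
                    g ∼ (+ H , + 0) ⊕ j₁ · u → ∀ P → NormalForm K P
    normal-form-C {H} {K} {j₀} {j₁} 0<H H≡ B∼ g∼ (i , J) = from-split (below-double ρ/3<K+K)
      where
      open ∼-Reasoning
      e = proj₁ (parity-bit J)
      x = i - a * J
      k = J + bit e * j₁
      reduced = reduce {H ℕ.+ H} {j₀} (ℕP.<-≤-trans 0<H (ℕP.m≤m+n H H)) B∼ (x + bit e * + H)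
      ρ = proj₁ reduced
      n = proj₁ (proj₂ (proj₂ reduced))
      A = (+ 3 * + (ρ / 3) , + 0)
      D = (+ (ρ % 3) - + 1 , + 0)
      ρ/3<K+K : ρ / 3 < K ℕ.+ K
      ρ/3<K+K = ℕDM.m<n*o⇒m/o<n (subst (ρ <_) (trans (cong (λ z → z ℕ.+ z) H≡) (sym (ℕP.*-distribʳ-+ 3 K K)))
                                              (proj₁ (proj₂ reduced)))
      lower : (i , J) ∼ A ⊕ (n + k) · u ⊕ bit false · g ⊕ D
      lower = begin
        (i , J)                                  ≈⟨ axis-form i J e (proj₂ (parity-bit J)) ⟩
        (x , + 0) ⊕ J · u ⊕ bit e · g            ≈⟨ fold-across g∼ x J e ⟩
        (x + bit e * + H , + 0) ⊕ k · u          ≈⟨ ∼-⊕ʳ (k · u) (proj₂ (proj₂ (proj₂ reduced))) ⟩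
        A ⊕ n · u ⊕ D ⊕ k · u                    ≡⟨ sym (⊕-𝟎 (A ⊕ n · u ⊕ D ⊕ k · u)) ⟩
        A ⊕ n · u ⊕ D ⊕ k · u ⊕ bit false · g    ≡⟨ ⊕-shuffle A n k u D (bit false · g) ⟩
        A ⊕ (n + k) · u ⊕ bit false · g ⊕ D      ∎
      from-split : ρ / 3 < K ⊎ Σ ℕ (λ r → r < K × ρ / 3 ≡ r ℕ.+ K) → NormalForm K (i , J)
      from-split (inj₁ ρ/3<K) = ρ / 3 , ρ/3<K , ρ % 3 , ℕDM.m%n<n ρ 3 , false , n + k , lower
      from-split (inj₂ (r , r<K , ρ/3≡r+K)) =
        r , r<K , ρ % 3 , ℕDM.m%n<n ρ 3 , true , n + k - j₁ ,
        ∼-trans (subst (λ z → (i , J) ∼ (+ 3 * + z , + 0) ⊕ (n + k) · u ⊕ bit false · g ⊕ D) ρ/3≡r+K lower)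
                (upper-half H≡ g∼ r (n + k) D)

    skew-codeword : ∀ r t j → + 1 * proj₁ (codeword a r t j) + - a * proj₂ (codeword a r t j) ≡
                              + 3 * + r + (j + t) * (cVal m h - a * + halfL l)
    skew-codeword r t j = skew (+ 3 * + r) a j t (cVal m h) (+ halfL l)
      where
      skew : ∀ R a j t c x → + 1 * (R + a * j + (j + t) * c) + - a * (j + (j + t) * x) ≡ R + (j + t) * (c - a * x)
      skew = solve-∀

    vertical-codeword : + halfL l ≡ + 1 mod + 2 → ∀ r t j →
                        + 0 * proj₁ (codeword a r t j) + + 1 * proj₂ (codeword a r t j) ≡ t mod + 2
    vertical-codeword hl≡1 r t j = begin
      + 0 * proj₁ (codeword a r t j) + + 1 * (j + (j + t) * x)  ≡⟨ drop (proj₁ (codeword a r t j)) j t x ⟩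
      j + (j + t) * x                                          ≈⟨ mod-+ (mod-refl j) (mod-*ˡ (j + t) hl≡1) ⟩
      j + (j + t) * + 1                                        ≡⟨ twice j t ⟩
      t + j * + 2                                              ≈⟨ mod-+ (mod-refl t) (multiple≡0 j) ⟩
      t + + 0                                                  ≡⟨ ℤP.+-identityʳ t ⟩
      t                                                        ∎
      where
      open mod-Reasoning (+ 2)
      x = + halfL l
      drop : ∀ X j t x → + 0 * X + + 1 * (j + (j + t) * x) ≡ j + (j + t) * x
      drop = solve-∀
      twice : ∀ j t → j + (j + t) * + 1 ≡ t + j * + 2
      twice = solve-∀

    skew-kills-hl : ∀ {N} → + l - a * + h ≡ + 0 mod N → + 1 * + h + - a * + l ≡ + 0 mod N
    skew-kills-hl {N} D≡0 = begin
      + 1 * + h + - a * + l        ≡⟨ reorder a (+ l) (+ h) ⟩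
      - a * + l + + 1 * + h        ≡⟨ cong (λ z → - a * + l + z * + h) (sign-square σ) ⟨
      - a * + l + (a * a) * + h    ≡⟨ factor a (+ l) (+ h) ⟩
      - a * (+ l - a * + h)        ≈⟨ mod-*ˡ (- a) D≡0 ⟩
      - a * + 0                    ≡⟨ ℤP.*-zeroʳ (- a) ⟩
      + 0                          ∎
      where
      open mod-Reasoning N
      reorder : ∀ a l h → + 1 * h + - a * l ≡ - a * l + + 1 * h
      reorder = solve-∀
      factor : ∀ a l h → - a * l + (a * a) * h ≡ - a * (l - a * h)
      factor = solve-∀

    packing-A : ∀ {B K} (t : Fin K → Bool) → B ≡ K ℕ.* 3 → + m ≡ + 0 mod + B → + l - a * + h ≡ + 0 mod + B →
                cVal m h - a * + halfL l ≡ + 0 mod + B → + l ≡ + 0 mod + 2 → + halfL l ≡ + 1 mod + 2 →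
                Tiling.Packing a K t
    packing-A {B} {K} t refl m≡0 D≡0 Y≡0 l≡0 hl≡1 {r} {r′} {j} {j′} {s} {s′} tiles∼ =
      same-row (FinP.toℕ-injective (proj₁ rows-digits))
      where
      open Tiling a K t
      module χ₁ = Character (+ B) (+ 1) (- a) (mod-trans (mod-reflexive (ℤP.*-identityˡ (+ m))) m≡0) (skew-kills-hl D≡0)
      module χ₂ = Character (+ 2) (+ 0) (+ 1) (mod-reflexive refl)
                            (mod-trans (mod-reflexive (trans (ℤP.+-identityˡ (+ 1 * + l)) (ℤP.*-identityˡ (+ l)))) l≡0)

      χ₁-tile : ∀ r j s → χ₁.χ (centre r j ⊕ step s) + + 1 ≡ + 3 * + toℕ r + + digit σ s mod + B
      χ₁-tile r j s = begin
        χ₁.χ (centre r j ⊕ step s) + + 1                            ≡⟨ cong (_+ + 1) (χ₁.χ-⊕ (centre r j) (step s)) ⟩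
        χ₁.χ (centre r j) + χ₁.χ (step s) + + 1                     ≡⟨ cong (λ z → z + χ₁.χ (step s) + + 1) (skew-codeword (toℕ r) (bit (t r)) j) ⟩
        + 3 * + toℕ r + (j + bit (t r)) * Y + χ₁.χ (step s) + + 1
          ≈⟨ mod-+ (mod-+ (mod-+ (mod-refl (+ 3 * + toℕ r)) (mod-*ˡ (j + bit (t r)) Y≡0)) (skew-step σ Y≡0 s))
                   (mod-refl (+ 1)) ⟩
        + 3 * + toℕ r + (j + bit (t r)) * + 0 + (+ digit σ s - + 1) + + 1   ≡⟨ settle (+ 3 * + toℕ r) (j + bit (t r)) (+ digit σ s) ⟩
        + 3 * + toℕ r + + digit σ s                                 ∎
        where
        open mod-Reasoning (+ B)
        Y = cVal m h - a * + halfL l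
        settle : ∀ R k d → R + k * + 0 + (d - + 1) + + 1 ≡ R + d
        settle = solve-∀

      χ₂-tile : ∀ r j s → χ₂.χ (centre r j ⊕ step s) ≡ bit (t r) + + vertical s mod + 2
      χ₂-tile r j s = mod-trans (mod-reflexive (χ₂.χ-⊕ (centre r j) (step s)))
                                (mod-+ (vertical-codeword hl≡1 (toℕ r) (bit (t r)) j) (vertical-step hl≡1 s))

      rows-digits : toℕ r ≡ toℕ r′ × digit σ s ≡ digit σ s′
      rows-digits = base3-mod-injective (FinP.toℕ<n r) (FinP.toℕ<n r′) (digit<3 σ s) (digit<3 σ s′)
        (mod-trans (mod-sym (χ₁-tile r j s))
          (mod-trans (mod-+ (χ₁.χ-∼ tiles∼) (mod-refl (+ 1))) (χ₁-tile r′ j′ s′)))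

      same-row : r ≡ r′ → r ≡ r′ × s ≡ s′
      same-row refl = refl , tile-injective σ (proj₂ rows-digits)
        (bounded-mod⇒≡ (vertical<2 s) (vertical<2 s′)
          (mod-cancelˡ (bit (t r)) (mod-trans (mod-sym (χ₂-tile r j s)) (mod-trans (χ₂.χ-∼ tiles∼) (χ₂-tile r j′ s′)))))

    twisted-kills-hl : ∀ {H} → + l - a * + h ≡ + 0 mod (+ H * + 2) → + l ≡ + 0 mod + 2 →
                       + 1 * + h + (+ H - a) * + l ≡ + 0 mod (+ H * + 2)
    twisted-kills-hl {H} D≡0 l≡0 = begin
      + 1 * + h + (+ H - a) * + l          ≡⟨ split a (+ h) (+ l) (+ H) ⟩
      (+ 1 * + h + - a * + l) + + H * + l  ≈⟨ mod-+ (skew-kills-hl D≡0) (mod-scale (+ H) l≡0) ⟩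
      + 0 + + H * + 0                      ≡⟨ cong (λ z → + 0 + z) (ℤP.*-zeroʳ (+ H)) ⟩
      + 0                                  ∎
      where
      open mod-Reasoning (+ H * + 2)
      split : ∀ a h l H → + 1 * h + (H - a) * l ≡ (+ 1 * h + - a * l) + H * l
      split = solve-∀

    twisted-codeword : ∀ {H} → cVal m h - a * + halfL l ≡ + H mod (+ H * + 2) → + halfL l ≡ + 0 mod + 2 → ∀ r t j →
                       + 1 * proj₁ (codeword a r t j) + (+ H - a) * proj₂ (codeword a r t j) ≡ + 3 * + r + t * + H mod (+ H * + 2)
    twisted-codeword {H} Y≡H hl≡0 r t j = begin
      + 1 * proj₁ (codeword a r t j) + (+ H - a) * proj₂ (codeword a r t j)
        ≡⟨ expand R a j t c x (+ H) ⟩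
      R + + H * j + (j + t) * (c - a * x) + (j + t) * (+ H * x)
        ≈⟨ mod-+ (mod-+ (mod-refl (R + + H * j)) (mod-*ˡ (j + t) Y≡H)) (mod-*ˡ (j + t) (mod-scale (+ H) hl≡0)) ⟩
      R + + H * j + (j + t) * + H + (j + t) * (+ H * + 0)
        ≡⟨ collect R (+ H) j t ⟩
      R + t * + H + j * (+ H * + 2)
        ≈⟨ mod-absorb (R + t * + H) j (+ H * + 2) ⟩
      R + t * + H ∎
      where
      open mod-Reasoning (+ H * + 2)
      R = + 3 * + r
      c = cVal m h
      x = + halfL l
      expand : ∀ R a j t c x H → + 1 * (R + a * j + (j + t) * c) + (H - a) * (j + (j + t) * x) ≡
                                 R + H * j + (j + t) * (c - a * x) + (j + t) * (H * x)
      expand = solve-∀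
      collect : ∀ R H j t → R + H * j + (j + t) * H + (j + t) * (H * + 0) ≡ R + t * H + j * (H * + 2)
      collect = solve-∀

    packing-C : ∀ {H K} (t : Fin K → Bool) → 0 < H → H ≡ K ℕ.* 3 → + m ≡ + 0 mod (+ H * + 2) →
                + l - a * + h ≡ + 0 mod (+ H * + 2) → cVal m h - a * + halfL l ≡ + H mod (+ H * + 2) →
                + l ≡ + 0 mod + 2 → + halfL l ≡ + 0 mod + 2 → Tiling.Packing a K t
    packing-C {H} {K} t 0<H refl m≡0 D≡0 Y≡H l≡0 hl≡0 {r} {r′} {j} {j′} {s} {s′} tiles∼ =
      same-row (FinP.toℕ-injective (proj₁ rows-digits))
      where
      open Tiling a K t
      module χ = Character (+ H * + 2) (+ 1) (+ H - a) (mod-trans (mod-reflexive (ℤP.*-identityˡ (+ m))) m≡0)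
                           (twisted-kills-hl D≡0 l≡0)

      X : Fin K → Tile → ℤ
      X r s = + 3 * + toℕ r + + digit σ s

      T : Fin K → Tile → ℤ
      T r s = bit (t r) + + vertical s

      χ-tile : ∀ r j s → χ.χ (centre r j ⊕ step s) + + 1 ≡ X r s + T r s * + H mod (+ H * + 2)
      χ-tile r j s = begin
        χ.χ (centre r j ⊕ step s) + + 1          ≡⟨ cong (_+ + 1) (χ.χ-⊕ (centre r j) (step s)) ⟩
        χ.χ (centre r j) + χ.χ (step s) + + 1
          ≈⟨ mod-+ (mod-+ (twisted-codeword Y≡H hl≡0 (toℕ r) (bit (t r)) j) (twisted-step σ Y≡H hl≡0 s))
                   (mod-refl (+ 1)) ⟩
        + 3 * + toℕ r + bit (t r) * + H + ((+ digit σ s - + 1) + + vertical s * + H) + + 1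
          ≡⟨ settle (+ 3 * + toℕ r) (bit (t r)) (+ digit σ s) (+ vertical s) (+ H) ⟩
        X r s + T r s * + H                      ∎
        where
        open mod-Reasoning (+ H * + 2)
        settle : ∀ R t d v H → R + t * H + ((d - + 1) + v * H) + + 1 ≡ R + d + (t + v) * H
        settle = solve-∀

      tiles≡ : X r s + T r s * + H ≡ X r′ s′ + T r′ s′ * + H mod (+ H * + 2)
      tiles≡ = mod-trans (mod-sym (χ-tile r j s))
                 (mod-trans (mod-+ (χ.χ-∼ tiles∼) (mod-refl (+ 1))) (χ-tile r′ j′ s′))

      rows-digits : toℕ r ≡ toℕ r′ × digit σ s ≡ digit σ s′
      rows-digits = base3-mod-injective (FinP.toℕ<n r) (FinP.toℕ<n r′) (digit<3 σ s) (digit<3 σ s′)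
        (mod-trans (mod-sym (mod-absorb (X r s) (T r s) (+ H)))
          (mod-trans (mod-divisor (+ 2) tiles≡) (mod-absorb (X r′ s′) (T r′ s′) (+ H))))

      same-row : r ≡ r′ → r ≡ r′ × s ≡ s′
      same-row refl = refl , tile-injective σ (proj₂ rows-digits)
        (bounded-mod⇒≡ (vertical<2 s) (vertical<2 s′)
          (mod-cancelˡ (bit (t r)) (mod-cancelʳ-factor (+ H) (+ 2) {{ℕ.>-nonZero 0<H}}
            (mod-cancelˡ (X r s) (mod-trans tiles≡
              (mod-reflexive (cong (λ d → + 3 * + toℕ r + + d + T r s′ * + H) (sym (proj₂ rows-digits)))))))))

    perfect-code-A : ∀ {B K j₀} (t : Fin K → Bool) → 0 < B → B ≡ K ℕ.* 3 → (+ B , + 0) ∼ j₀ · u →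
                     + m ≡ + 0 mod + B → + l - a * + h ≡ + 0 mod + B → cVal m h - a * + halfL l ≡ + 0 mod + B →
                     + l ≡ + 0 mod + 2 → + halfL l ≡ + 1 mod + 2 →
                     PerfectCode (IsVertex m l) (Adj'' m l h) (UnionC m l h a K t)
    perfect-code-A {B} {K} {j₀} t 0<B B≡ B∼ m≡0 D≡0 Y≡0 l≡0 hl≡1 =
      Tiling.tiling⇒perfect-code a K t (normal-forms-cover t (normal-form-A {B} {K} {j₀} 0<B B≡ B∼))
                                       (packing-A t B≡ m≡0 D≡0 Y≡0 l≡0 hl≡1)

    perfect-code-C : ∀ {H K j₀ j₁} (t : Fin K → Bool) → 0 < H → H ≡ K ℕ.* 3 →
                     (+ (H ℕ.+ H) , + 0) ∼ j₀ · u → g ∼ (+ H , + 0) ⊕ j₁ · u →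
                     + m ≡ + 0 mod (+ H * + 2) → + l - a * + h ≡ + 0 mod (+ H * + 2) →
                     cVal m h - a * + halfL l ≡ + H mod (+ H * + 2) → + l ≡ + 0 mod + 2 → + halfL l ≡ + 0 mod + 2 →
                     PerfectCode (IsVertex m l) (Adj'' m l h) (UnionC m l h a K t)
    perfect-code-C {H} {K} {j₀} {j₁} t 0<H H≡ B∼ g∼ m≡0 D≡0 Y≡H l≡0 hl≡0 =
      Tiling.tiling⇒perfect-code a K t (normal-forms-cover t (normal-form-C {H} {K} {j₀} {j₁} 0<H H≡ B∼ g∼))
                                       (packing-C t 0<H H≡ m≡0 D≡0 Y≡H l≡0 hl≡0)

-- The numbers b and c

module Parameters (m l h : ℕ) (σ : Sign) (0<m : 0 < m) (0<l : 0 < l) (2∣m : 2 ∣ m) (2∣h : 2 ∣ h) (2∣l : 2 ∣ l) where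
  open Lattice m l h

  a : ℤ
  a = σ ◃ 1

  D : ℤ
  D = + l - a * + h

  b : ℕ
  b = bVal m l h a

  c : ℤ
  c = cVal m h

  hl : ℕ
  hl = halfL l

  Y : ℤ
  Y = c - a * + hl

  b∣m : b ∣ m
  b∣m = gcd[m,n]∣n ∣ D ∣ m

  m≡0 : + m ≡ + 0 mod + b
  m≡0 = ∣⇒≡0-mod b∣m

  D≡0 : D ≡ + 0 mod + b
  D≡0 = ∣abs⇒≡0-mod D (gcd[m,n]∣m ∣ D ∣ m)

  0<b : 0 < b
  0<b = ℕP.n≢0⇒n>0 (gcd[m,n]≢0 ∣ D ∣ m (inj₂ (ℕP.>⇒≢ 0<m)))

  double : ∀ x → x * + 2 ≡ x + x
  double = solve-∀

  l≡hl+hl : + l ≡ + hl + + hl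
  l≡hl+hl = trans (halves 2∣l) (double (+ hl))

  κ : ℕ
  κ = quotient (n∣lcm[m,n] h m)

  lcm≡κm : + lcm h m ≡ + κ * + m
  lcm≡κm = trans (cong +_ (_∣_.equality (n∣lcm[m,n] h m))) (ℤP.pos-* κ m)

  c+c : c + c ≡ + m + + h - + κ * + m
  c+c = begin
    c + c                           ≡⟨ double c ⟨
    c * + 2                         ≡⟨ divN-exact X (s≤s z≤n) X≡0 ⟨
    + m + + h - + lcm h m           ≡⟨ cong (λ z → + m + + h - z) lcm≡κm ⟩
    + m + + h - + κ * + m           ∎
    where
    open ≡-Reasoning
    X = + m + + h - + lcm h m
    X≡0 : X ≡ + 0 mod + 2
    X≡0 = mod-+ (mod-+ (∣⇒≡0-mod 2∣m) (∣⇒≡0-mod 2∣h)) (mod-neg (∣⇒≡0-mod (∣-trans 2∣m (n∣lcm[m,n] h m))))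

  g⊕g∈Λ : InΛ (g ⊕ g)
  g⊕g∈Λ = + 1 - + κ , + 1 , trans c+c (factor (+ m) (+ h) (+ κ)) , trans (sym l≡hl+hl) (sym (ℤP.*-identityˡ (+ l)))
    where
    factor : ∀ m h κ → m + h - κ * m ≡ (+ 1 - κ) * m + + 1 * h
    factor = solve-∀

  Y+Y≡0 : Y + Y ≡ + 0 mod + b
  Y+Y≡0 = begin
    Y + Y                                              ≡⟨ regroup c a (+ hl) ⟩
    (c + c) - a * (+ hl + + hl)                        ≡⟨ cong₂ (λ u v → u - a * v) c+c (sym l≡hl+hl) ⟩
    (+ m + + h - + κ * + m) - a * + l                  ≡⟨ expand (+ m) (+ h) (+ κ) a (+ l) ⟩
    (+ 1 - + κ) * + m - a * + l + + 1 * + h            ≡⟨ cong (λ z → (+ 1 - + κ) * + m - a * + l + z * + h) (sign-square σ) ⟨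
    (+ 1 - + κ) * + m - a * + l + (a * a) * + h        ≡⟨ factor (+ m) (+ h) (+ κ) a (+ l) ⟩
    (+ 1 - + κ) * + m + - a * D                        ≈⟨ mod-+ (mod-*ˡ (+ 1 - + κ) m≡0) (mod-*ˡ (- a) D≡0) ⟩
    (+ 1 - + κ) * + 0 + - a * + 0                      ≡⟨ cong₂ _+_ (ℤP.*-zeroʳ (+ 1 - + κ)) (ℤP.*-zeroʳ (- a)) ⟩
    + 0                                                ∎
    where
    open mod-Reasoning (+ b)
    regroup : ∀ c a x → (c - a * x) + (c - a * x) ≡ (c + c) - a * (x + x)
    regroup = solve-∀
    expand : ∀ m h κ a l → (m + h - κ * m) - a * l ≡ (+ 1 - κ) * m - a * l + + 1 * h
    expand = solve-∀
    factor : ∀ m h κ a l → (+ 1 - κ) * m - a * l + (a * a) * h ≡ (+ 1 - κ) * m + - a * (l - a * h)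
    factor = solve-∀

  open Cayley m l h 0<m 0<l g⊕g∈Λ public
  open Signed σ public hiding (a)

  D-axis : (D , + 0) ∼ (a * + l) · u
  D-axis = ∼-by (subst InΛ (cong₂ _,_ first second) (Λ-⊕ (Λ-· (- a) Λ-hl) (Λ-· (- (a * + hl)) g⊕g∈Λ)))
    where
    x = + hl
    expand₁ : ∀ a h x c → - a * h + - (a * x) * (c + c) ≡
                          ((x + x) - a * h) - (a * (x + x)) * (a + c) + (a * a - + 1) * (x + x)
    expand₁ = solve-∀
    first : - a * + h + - (a * x) * (c + c) ≡ D - (a * + l) * (a + c)
    first = begin
      - a * + h + - (a * x) * (c + c)
        ≡⟨ expand₁ a (+ h) x c ⟩
      ((x + x) - a * + h) - (a * (x + x)) * (a + c) + (a * a - + 1) * (x + x)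
        ≡⟨ cong (λ z → ((x + x) - a * + h) - (a * (x + x)) * (a + c) + (z - + 1) * (x + x)) (sign-square σ) ⟩
      ((x + x) - a * + h) - (a * (x + x)) * (a + c) + + 0
        ≡⟨ ℤP.+-identityʳ _ ⟩
      ((x + x) - a * + h) - (a * (x + x)) * (a + c)
        ≡⟨ cong (λ L → (L - a * + h) - (a * L) * (a + c)) (sym l≡hl+hl) ⟩
      D - (a * + l) * (a + c) ∎
      where open ≡-Reasoning
    expand₂ : ∀ a x → - a * (x + x) + - (a * x) * (x + x) ≡ + 0 - (a * (x + x)) * (+ 1 + x)
    expand₂ = solve-∀
    second : - a * + l + - (a * x) * (x + x) ≡ + 0 - (a * + l) * (+ 1 + x)
    second = subst (λ L → - a * L + - (a * x) * (x + x) ≡ + 0 - (a * L) * (+ 1 + x)) (sym l≡hl+hl) (expand₂ a x)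

  j₀ : ℤ
  j₀ = proj₁ (bezout D m) * (a * + l)

  b-axis : (+ b , + 0) ∼ j₀ · u
  b-axis = begin
    (+ b , + 0)                          ≡⟨ cong₂ _,_ (proj₂ (proj₂ (bezout D m))) (sym (cong₂ _+_ (ℤP.*-zeroʳ X) (ℤP.*-zeroʳ Y′))) ⟩
    X · (D , + 0) ⊕ Y′ · (+ m , + 0)     ≈⟨ ∼-⊕ (∼-· X D-axis) (Λ⇒∼𝟎 (Λ-· Y′ Λ-m)) ⟩
    X · ((a * + l) · u) ⊕ 𝟎              ≡⟨ ⊕-𝟎 (X · ((a * + l) · u)) ⟩
    X · ((a * + l) · u)                  ≡⟨ cong₂ _,_ (ℤP.*-assoc X (a * + l) (proj₁ u)) (ℤP.*-assoc X (a * + l) (proj₂ u)) ⟨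
    j₀ · u                               ∎
    where
    open ∼-Reasoning
    X = proj₁ (bezout D m)
    Y′ = proj₁ (proj₂ (bezout D m))

  g-twist : ∀ {H z} → Y ≡ + H + + b * z → (+ 1 + + hl) · g ∼ (+ H , + 0) ⊕ (+ hl + z * j₀) · u
  g-twist {H} {z} Y≡ = begin
    (+ 1 + + hl) · g                                  ≡⟨ cong₂ _,_ first (second z (+ hl)) ⟩
    (+ H , + 0) ⊕ z · (+ b , + 0) ⊕ + hl · u           ≈⟨ ∼-⊕ʳ (+ hl · u) (∼-⊕ˡ (+ H , + 0) (∼-· z b-axis)) ⟩
    (+ H , + 0) ⊕ z · (j₀ · u) ⊕ + hl · u              ≡⟨ cong₂ _,_ (collect (+ H) z j₀ (+ hl) (proj₁ u)) (collect (+ 0) z j₀ (+ hl) (proj₂ u)) ⟩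
    (+ H , + 0) ⊕ (+ hl + z * j₀) · u                  ∎
    where
    open ∼-Reasoning
    x = + hl
    split : ∀ a c x → (+ 1 + x) * c ≡ (c - a * x) + x * (a + c)
    split = solve-∀
    reorder : ∀ H b z → H + b * z ≡ H + z * b
    reorder = solve-∀
    first : (+ 1 + x) * c ≡ + H + z * + b + x * (a + c)
    first = trans (split a c x) (cong (_+ x * (a + c)) (trans Y≡ (reorder (+ H) (+ b) z)))
    second : ∀ z x → (+ 1 + x) * x ≡ + 0 + z * + 0 + x * (+ 1 + x)
    second = solve-∀
    collect : ∀ H z j x y → H + z * (j * y) + x * y ≡ H + (x + z * j) * y
    collect = solve-∀

  H-axis : ∀ {H z} → Y ≡ + H + + b * z → + hl ≡ + 1 mod + 2 → (+ H , + 0) ∼ (- (+ hl + z * j₀)) · u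
  H-axis {H} {z} Y≡ hl≡1 = begin
    (+ H , + 0)                                       ≡⟨ cong₂ _,_ (cancel (+ H) k (proj₁ u)) (cancel (+ 0) k (proj₂ u)) ⟩
    (+ H , + 0) ⊕ k · u ⊕ (- k) · u                   ≈⟨ ∼-⊕ʳ ((- k) · u) (g-twist Y≡) ⟨
    (+ 1 + + hl) · g ⊕ (- k) · u
      ≈⟨ ∼-⊕ʳ ((- k) · u) (·g-mod-2 (+ 1 + + hl) (+ 0) (mod-trans (mod-+ (mod-refl (+ 1)) hl≡1) (+ 1 , refl))) ⟩
    + 0 · g ⊕ (- k) · u                               ≡⟨ cong₂ _,_ (ℤP.+-identityˡ _) (ℤP.+-identityˡ _) ⟩
    (- k) · u                                         ∎
    where
    open ∼-Reasoning
    k = + hl + z * j₀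
    cancel : ∀ H k y → H ≡ H + k * y + - k * y
    cancel = solve-∀

  g-axis : ∀ {H z} → Y ≡ + H + + b * z → + hl ≡ + 0 mod + 2 → g ∼ (+ H , + 0) ⊕ (+ hl + z * j₀) · u
  g-axis {H} {z} Y≡ hl≡0 = begin
    g                    ≡⟨ cong₂ _,_ (ℤP.*-identityˡ c) (ℤP.*-identityˡ (+ hl)) ⟨
    + 1 · g              ≈⟨ ·g-mod-2 (+ 1) (+ 1 + + hl) (mod-sym (mod-+ (mod-refl (+ 1)) hl≡0)) ⟩
    (+ 1 + + hl) · g     ≈⟨ g-twist Y≡ ⟩
    (+ H , + 0) ⊕ (+ hl + z * j₀) · u ∎
    where open ∼-Reasoning

  Y-even : c ≡ + 1 mod + 2 → + hl ≡ + 1 mod + 2 → Y ≡ + 0 mod + 2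
  Y-even c≡1 hl≡1 = begin
    c - a * + hl      ≈⟨ mod-+ c≡1 (mod-neg (mod-*ˡ a hl≡1)) ⟩
    + 1 - a * + 1     ≡⟨ cong (λ z → + 1 - z) (ℤP.*-identityʳ a) ⟩
    + 1 - a           ≈⟨ mod-+ (mod-refl (+ 1)) (mod-neg (sign-odd σ)) ⟩
    + 0               ∎
    where open mod-Reasoning (+ 2)

  module ValuationOne (m-val : HasVal2 m 1) (l-val : HasVal2 l 1) (3∣b : 3 ∣ b) where

    M η : ℕ
    M = m / 2
    η = h / 2

    M≡1 : + M ≡ + 1 mod + 2
    M≡1 = half-odd 2∣m (proj₂ m-val)

    hl≡1 : + hl ≡ + 1 mod + 2
    hl≡1 = half-odd 2∣l (proj₂ l-val)

    c≡ : c ≡ + M * (+ 1 - + κ) + + η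
    c≡ = ℤP.*-cancelʳ-≡ c (+ M * (+ 1 - + κ) + + η) (+ 2) (begin
      c * + 2                                   ≡⟨ double c ⟩
      c + c                                     ≡⟨ c+c ⟩
      + m + + h - + κ * + m                     ≡⟨ cong₂ (λ x y → x + y - + κ * x) (halves 2∣m) (halves 2∣h) ⟩
      + M * + 2 + + η * + 2 - + κ * (+ M * + 2) ≡⟨ factor (+ M) (+ η) (+ κ) ⟩
      (+ M * (+ 1 - + κ) + + η) * + 2           ∎)
      where
      open ≡-Reasoning
      factor : ∀ M η κ → M * + 2 + η * + 2 - κ * (M * + 2) ≡ (M * (+ 1 - κ) + η) * + 2
      factor = solve-∀

    κ-even : + η ≡ + 0 mod + 2 → + κ ≡ + 0 mod + 2
    κ-even η≡0 = even-factor (mod-cancelʳ-factor (+ 2) (+ 2) (begin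
      + κ * + M * + 2       ≡⟨ reassoc (+ κ) (+ M) ⟩
      + κ * (+ M * + 2)     ≡⟨ cong (+ κ *_) (halves 2∣m) ⟨
      + κ * + m             ≡⟨ lcm≡κm ⟨
      + lcm h m             ≈⟨ ∣⇒≡0-mod (∣-trans 4∣h (m∣lcm[m,n] h m)) ⟩
      + 0                   ∎)) M≡1
      where
      open mod-Reasoning (+ 2 * + 2)
      reassoc : ∀ κ M → κ * M * + 2 ≡ κ * (M * + 2)
      reassoc = solve-∀
      4∣h : 4 ∣ h
      4∣h with ≡0-mod⇒∣ η≡0
      ... | divides q eq = divides q (trans (sym (ℕDM.m/n*n≡m 2∣h)) (trans (cong (ℕ._* 2) eq) (ℕP.*-assoc q 2 2)))

    κ-odd : + η ≡ + 1 mod + 2 → + κ ≡ + 1 mod + 2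
    κ-odd η≡1 = odd-factor (+ ν) (mod-trans (mod-reflexive (sym η≡νκ)) η≡1)
      where
      η*m≡M*h : η ℕ.* m ≡ M ℕ.* h
      η*m≡M*h = ℤP.+-injective (begin
        + (η ℕ.* m)           ≡⟨ ℤP.pos-* η m ⟩
        + η * + m             ≡⟨ cong (+ η *_) (halves 2∣m) ⟩
        + η * (+ M * + 2)     ≡⟨ swap (+ η) (+ M) ⟩
        + M * (+ η * + 2)     ≡⟨ cong (+ M *_) (halves 2∣h) ⟨
        + M * + h             ≡⟨ ℤP.pos-* M h ⟨
        + (M ℕ.* h)           ∎)
        where
        open ≡-Reasoning
        swap : ∀ η M → η * (M * + 2) ≡ M * (η * + 2)
        swap = solve-∀
      lcm∣ηm : lcm h m ∣ η ℕ.* m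
      lcm∣ηm = lcm-least (divides M η*m≡M*h) (divides η refl)
      ν = quotient lcm∣ηm
      η≡νκ : + η ≡ + ν * + κ
      η≡νκ = ℤP.*-cancelʳ-≡ (+ η) (+ ν * + κ) (+ m) {{ℕ.>-nonZero 0<m}} (begin
        + η * + m             ≡⟨ ℤP.pos-* η m ⟨
        + (η ℕ.* m)           ≡⟨ cong +_ (_∣_.equality lcm∣ηm) ⟩
        + (ν ℕ.* lcm h m)     ≡⟨ ℤP.pos-* ν (lcm h m) ⟩
        + ν * + lcm h m       ≡⟨ cong (+ ν *_) lcm≡κm ⟩
        + ν * (+ κ * + m)     ≡⟨ ℤP.*-assoc (+ ν) (+ κ) (+ m) ⟨
        + ν * + κ * + m       ∎)
        where open ≡-Reasoning

    c≡1 : c ≡ + 1 mod + 2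
    c≡1 with parity (+ η)
    ... | inj₁ η≡0 = begin
      c                                 ≡⟨ c≡ ⟩
      + M * (+ 1 - + κ) + + η           ≈⟨ mod-+ (mod-*ˡ (+ M) (mod-+ (mod-refl (+ 1)) (mod-neg (κ-even η≡0)))) η≡0 ⟩
      + M * (+ 1 - + 0) + + 0           ≡⟨ ℤP.+-identityʳ (+ M * (+ 1 - + 0)) ⟩
      + M * + 1                         ≡⟨ ℤP.*-identityʳ (+ M) ⟩
      + M                               ≈⟨ M≡1 ⟩
      + 1                               ∎
      where open mod-Reasoning (+ 2)
    ... | inj₂ η≡1 = begin
      c                                 ≡⟨ c≡ ⟩
      + M * (+ 1 - + κ) + + η           ≈⟨ mod-+ (mod-*ˡ (+ M) (mod-+ (mod-refl (+ 1)) (mod-neg (κ-odd η≡1)))) η≡1 ⟩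
      + M * (+ 1 - + 1) + + 1           ≡⟨ cong (_+ + 1) (ℤP.*-zeroʳ (+ M)) ⟩
      + 1                               ∎
      where open mod-Reasoning (+ 2)

    2∣b : 2 ∣ b
    2∣b = gcd-greatest (≡0-mod⇒∣ D-even) 2∣m
      where
      D-even : D ≡ + 0 mod + 2
      D-even = mod-+ (∣⇒≡0-mod 2∣l) (mod-neg (mod-trans (mod-*ˡ a (∣⇒≡0-mod 2∣h)) (mod-reflexive (ℤP.*-zeroʳ a))))

    H : ℕ
    H = b / 2

    H≡1 : + H ≡ + 1 mod + 2
    H≡1 = half-odd 2∣b (λ 4∣b → proj₂ m-val (∣-trans 4∣b b∣m))

    q : ℤ
    q = _≡_mod_.quotient Y+Y≡0

    Y≡qH : Y ≡ q * + H
    Y≡qH = double-cancel {Y} {q} {+ H}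
             (trans (sym (ℤP.+-identityʳ (Y + Y))) (trans (_≡_mod_.difference Y+Y≡0) (cong (q *_) (halves 2∣b))))

    q-even : q ≡ + 0 mod + 2
    q-even = even-factor {q} {+ H} (mod-trans (mod-reflexive (sym Y≡qH)) (Y-even c≡1 hl≡1)) H≡1

    Y≡0 : Y ≡ + 0 mod + b
    Y≡0 = from-even q-even
      where
      swap : ∀ w H → w * + 2 * H ≡ w * (H * + 2)
      swap = solve-∀
      from-even : q ≡ + 0 mod + 2 → Y ≡ + 0 mod + b
      from-even (w , q≡w2) = w , (begin
        Y - + 0          ≡⟨ ℤP.+-identityʳ Y ⟩
        Y                ≡⟨ Y≡qH ⟩
        q * + H          ≡⟨ cong (_* + H) (trans (sym (ℤP.+-identityʳ q)) q≡w2) ⟩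
        w * + 2 * + H    ≡⟨ swap w (+ H) ⟩
        w * (+ H * + 2)  ≡⟨ cong (w *_) (halves 2∣b) ⟨
        w * + b          ∎)
        where open ≡-Reasoning

    perfect-code : (t : Fin (b / 3) → Bool) → PerfectCode (IsVertex m l) (Adj'' m l h) (UnionC m l h a (b / 3) t)
    perfect-code t =
      perfect-code-A {b} {b / 3} {j₀} t 0<b (sym (ℕDM.m/n*n≡m 3∣b)) b-axis m≡0 D≡0 Y≡0 (∣⇒≡0-mod 2∣l) hl≡1

  module ValuationGap (sm sl : ℕ) (m-val : HasVal2 m sm) (l-val : HasVal2 l sl) (h-val : Val2≥ h sm)
                      (sl<sm : sl < sm) (1≤sl : 1 ≤ sl) (3∣b : 3 ∣ b) where

    P : ℕ
    P = 2 ^ sl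

    P∣b : P ∣ b
    P∣b = gcd-greatest (≡0-mod⇒∣ D≡0-mod-P) (∣-trans (2^-∣ (ℕP.<⇒≤ sl<sm)) (proj₁ m-val))
      where
      D≡0-mod-P : D ≡ + 0 mod + P
      D≡0-mod-P = mod-+ (∣⇒≡0-mod (proj₁ l-val))
                        (mod-neg (mod-trans (mod-*ˡ a (∣⇒≡0-mod (∣-trans (2^-∣ (ℕP.<⇒≤ sl<sm)) h-val)))
                                            (mod-reflexive (ℤP.*-zeroʳ a))))

    2∣b : 2 ∣ b
    2∣b = ∣-trans (2^-∣ 1≤sl) P∣b

    H : ℕ
    H = b / 2

    y′ : ℤ
    y′ = _≡_mod_.quotient Y+Y≡0

    Y+Y≡y′b : Y + Y ≡ y′ * + b
    Y+Y≡y′b = trans (sym (ℤP.+-identityʳ (Y + Y))) (_≡_mod_.difference Y+Y≡0)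

    Y≡y′H : Y ≡ y′ * + H
    Y≡y′H = double-cancel {Y} {y′} {+ H} (trans Y+Y≡y′b (cong (y′ *_) (halves 2∣b)))

    l≡0-mod-2P : y′ ≡ + 0 mod + 2 → + l ≡ + 0 mod (+ 2 * + P)
    l≡0-mod-2P (w , y′≡w2) = begin
      + l                                  ≡⟨ ℤP.*-identityˡ (+ l) ⟨
      + 1 * + l                            ≡⟨ cong (_* + l) (sign-square σ) ⟨
      (a * a) * + l                        ≡⟨ unfold a (+ l) c Y ⟩
      a * (a * + l - ((c + c) - (Y + Y))) + a * ((c + c) - (Y + Y))
                                           ≡⟨ cong (λ z → a * z + a * ((c + c) - (Y + Y))) Y+Y-relation ⟩
      a * + 0 + a * ((c + c) - (Y + Y))
        ≡⟨ cong₂ (λ z w′ → a * + 0 + a * (z - w′)) c+c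
                 (trans Y+Y≡y′b (cong (_* + b) (trans (sym (ℤP.+-identityʳ y′)) y′≡w2))) ⟩
      a * + 0 + a * ((+ m + + h - + κ * + m) - w * + 2 * + b)
                                           ≈⟨ mod-+ (mod-refl (a * + 0))
                                                    (mod-*ˡ a (mod-+ (mod-+ (mod-+ m≡0′ h≡0′) (mod-neg (mod-*ˡ (+ κ) m≡0′)))
                                                                     (mod-neg (mod-trans (mod-reflexive (reassoc w (+ b))) (mod-*ˡ w 2b≡0))))) ⟩
      a * + 0 + a * ((+ 0 + + 0 + - (+ κ * + 0)) + - (w * (+ 2 * + 0)))
                                           ≡⟨ zeros a (+ κ) w ⟩
      + 0                                  ∎
      where
      open mod-Reasoning (+ 2 * + P)
      Q∣ : ∀ {n} → 2 ^ suc sl ∣ n → + n ≡ + 0 mod (+ 2 * + P)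
      Q∣ {n} d = subst (λ k → + n ≡ + 0 mod k) (ℤP.pos-* 2 P) (∣⇒≡0-mod d)
      m≡0′ = Q∣ (∣-trans (2^-∣ sl<sm) (proj₁ m-val))
      h≡0′ = Q∣ (∣-trans (2^-∣ sl<sm) h-val)
      2b≡0 : + 2 * + b ≡ + 2 * + 0 mod (+ 2 * + P)
      2b≡0 = mod-scale (+ 2) (∣⇒≡0-mod P∣b)
      unfold : ∀ a l c Y → (a * a) * l ≡ a * (a * l - ((c + c) - (Y + Y))) + a * ((c + c) - (Y + Y))
      unfold = solve-∀
      Y+Y-relation : a * + l - ((c + c) - (Y + Y)) ≡ + 0
      Y+Y-relation = trans (cong (λ L → a * L - ((c + c) - (Y + Y))) l≡hl+hl) (cancel c a (+ hl))
        where
        cancel : ∀ c a x → a * (x + x) - ((c + c) - ((c - a * x) + (c - a * x))) ≡ + 0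
        cancel = solve-∀
      reassoc : ∀ w b → w * + 2 * b ≡ w * (+ 2 * b)
      reassoc = solve-∀
      zeros : ∀ a κ w → a * + 0 + a * ((+ 0 + + 0 + - (κ * + 0)) + - (w * (+ 2 * + 0))) ≡ + 0
      zeros = solve-∀

    y′-odd : y′ ≡ + 1 mod + 2
    y′-odd = from-parity (parity y′)
      where
      from-parity : y′ ≡ + 0 mod + 2 ⊎ y′ ≡ + 1 mod + 2 → y′ ≡ + 1 mod + 2
      from-parity (inj₂ odd) = odd
      from-parity (inj₁ even) =
        ⊥-elim (proj₂ l-val (≡0-mod⇒∣ (subst (λ k → + l ≡ + 0 mod k) (sym (ℤP.pos-* 2 P)) (l≡0-mod-2P even))))

    b≡2H : + b ≡ + H * + 2
    b≡2H = halves 2∣b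

    H≡3K : H ≡ (b / 6) ℕ.* 3
    H≡3K = ℕP.*-cancelʳ-≡ H (b / 6 ℕ.* 3) 2 (begin
      H ℕ.* 2              ≡⟨ ℕDM.m/n*n≡m 2∣b ⟩
      b                    ≡⟨ ℕDM.m/n*n≡m (lcm-least 2∣b 3∣b) ⟨
      b / 6 ℕ.* 6          ≡⟨ ℕP.*-assoc (b / 6) 3 2 ⟨
      b / 6 ℕ.* 3 ℕ.* 2    ∎)
      where open ≡-Reasoning

    0<H : 0 < H
    0<H = ℕP.n≢0⇒n>0 (λ H≡0 → ℕP.>⇒≢ 0<b (trans (sym (ℕDM.m/n*n≡m 2∣b)) (cong (ℕ._* 2) H≡0)))

    over-2H : ∀ {x y} → x ≡ y mod + b → x ≡ y mod (+ H * + 2)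
    over-2H {x} {y} = subst (λ k → x ≡ y mod k) b≡2H

    perfect-code : (t : Fin (b / 6) → Bool) → PerfectCode (IsVertex m l) (Adj'' m l h) (UnionC m l h a (b / 6) t)
    perfect-code t = from-twist y′-odd
      where
      from-twist : y′ ≡ + 1 mod + 2 → PerfectCode (IsVertex m l) (Adj'' m l h) (UnionC m l h a (b / 6) t)
      from-twist (z , y′-1≡2z) = from-parity (parity (+ hl))
        where
        expand : ∀ y z H → y - + 1 ≡ z * + 2 → y * H ≡ H + (H * + 2) * z
        expand y z H eq = trans (cong (_* H) (trans (isolate y) (cong (_+ + 1) eq))) (distrib z H)
          where
          isolate : ∀ y → y ≡ y - + 1 + + 1
          isolate = solve-∀
          distrib : ∀ z H → (z * + 2 + + 1) * H ≡ H + (H * + 2) * z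
          distrib = solve-∀
        Y≡H+bz : Y ≡ + H + + b * z
        Y≡H+bz = trans Y≡y′H (trans (expand y′ z (+ H) y′-1≡2z) (cong (λ B → + H + B * z) (sym b≡2H)))
        from-parity : + hl ≡ + 0 mod + 2 ⊎ + hl ≡ + 1 mod + 2 →
                      PerfectCode (IsVertex m l) (Adj'' m l h) (UnionC m l h a (b / 6) t)
        from-parity (inj₂ hl≡1) =
          perfect-code-A {H} {b / 6} { - (+ hl + z * j₀) } t 0<H H≡3K (H-axis {H} {z} Y≡H+bz hl≡1)
            (mod-divisor (+ 2) (over-2H m≡0)) (mod-divisor (+ 2) (over-2H D≡0)) (y′ , trans (ℤP.+-identityʳ Y) Y≡y′H)
            (∣⇒≡0-mod 2∣l) hl≡1
        from-parity (inj₁ hl≡0) =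
          perfect-code-C {H} {b / 6} {j₀} {+ hl + z * j₀} t 0<H H≡3K
            (subst (λ B → (B , + 0) ∼ j₀ · u) (trans b≡2H (double (+ H))) b-axis)
            (g-axis {H} {z} Y≡H+bz hl≡0) (over-2H m≡0) (over-2H D≡0)
            (over-2H (z , trans (cong (_- + H) Y≡H+bz) (trans (cancel (+ H) (+ b * z)) (ℤP.*-comm (+ b) z))))
            (∣⇒≡0-mod 2∣l) hl≡0
          where
          cancel : ∀ H x → H + x - H ≡ x
          cancel = solve-∀

Conclusion : ℕ → ℕ → ℕ → ℤ → Set
Conclusion m l h a =
    (HasVal2 m 1 → HasVal2 l 1 → Val2≥ h 1 →
      (t : Fin (bVal m l h a / 3) → Bool) →
      PerfectCode (IsVertex m l) (Adj'' m l h) (UnionC m l h a (bVal m l h a / 3) t))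
  × ((sm sl : ℕ) → HasVal2 m sm → HasVal2 l sl → Val2≥ h sm → sl < sm → 1 ≤ sl →
      (t : Fin (bVal m l h a / 6) → Bool) →
      PerfectCode (IsVertex m l) (Adj'' m l h) (UnionC m l h a (bVal m l h a / 6) t))

conclusion-for-sign : ∀ σ {m l h} → h < m → 0 < l → 6 ∣ m → 3 ∣ ∣ + l - (σ ◃ 1) * + h ∣ →
                      Conclusion m l h (σ ◃ 1)
conclusion-for-sign σ {m} {l} {h} h<m 0<l 6∣m 3∣D = valuation-one , valuation-gap
  where
  0<m : 0 < m
  0<m = ℕP.≤-<-trans z≤n h<m
  2∣m : 2 ∣ m
  2∣m = ∣-trans (divides 3 refl) 6∣m
  3∣b : 3 ∣ bVal m l h (σ ◃ 1)
  3∣b = gcd-greatest 3∣D (∣-trans (divides 2 refl) 6∣m)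
  valuation-one = λ m-val l-val h-val →
    Parameters.ValuationOne.perfect-code m l h σ 0<m 0<l 2∣m h-val (proj₁ l-val) m-val l-val 3∣b
  valuation-gap = λ sm sl m-val l-val h-val sl<sm 1≤sl →
    Parameters.ValuationGap.perfect-code m l h σ 0<m 0<l 2∣m
      (∣-trans (2^-∣ (ℕP.≤-trans 1≤sl (ℕP.<⇒≤ sl<sm))) h-val) (∣-trans (2^-∣ 1≤sl) (proj₁ l-val))
      sm sl m-val l-val h-val sl<sm 1≤sl 3∣b

proposition2p9 :
    (m l h : ℕ) (a : ℤ) →
    h < m → 0 < l → 6 ∣ m →
    (a ≡ + 1 ⊎ a ≡ - + 1) →
    (+ 3) ℤD.∣ (+ l - a * + h) →
    ((HasVal2 m 1 → HasVal2 l 1 → Val2≥ h 1 →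
      (t : Fin (bVal m l h a / 3) → Bool) →
      PerfectCode (IsVertex m l) (Adj'' m l h) (UnionC m l h a (bVal m l h a / 3) t))
    ×
     ((sm sl : ℕ) → HasVal2 m sm → HasVal2 l sl → Val2≥ h sm → sl < sm → 1 ≤ sl →
      (t : Fin (bVal m l h a / 6) → Bool) →
      PerfectCode (IsVertex m l) (Adj'' m l h) (UnionC m l h a (bVal m l h a / 6) t)))
proposition2p9 m l h _ h<m 0<l 6∣m (inj₁ refl) 3∣D = conclusion-for-sign Sign.+ h<m 0<l 6∣m 3∣D
proposition2p9 m l h _ h<m 0<l 6∣m (inj₂ refl) 3∣D = conclusion-for-sign Sign.- h<m 0<l 6∣m 3∣D
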